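{- (Decidability of type checking.) All typing judgments of CoLF are algorithmically decidable: given the inputs, it is decidable whether $\Sigma\ \mathsf{sig}$, $\vdash_\Sigma\Xi\ \mathsf{sig}$, $\vdash_{\Xi;\Sigma}\Gamma\ \mathsf{ctx}$, $\Gamma\vdash_{\Xi;\Sigma}K\Leftarrow\mathsf{kind}$, $\Gamma\vdash_{\Xi;\Sigma}A\Leftarrow\mathsf{type}/\mathsf{cotype}$, $\Gamma\vdash_{\Xi;\Sigma}M\Leftarrow A$, $\Gamma\vdash_\Sigma A_1=A_2$ and $\Gamma\vdash_\Sigma P_1=P_2$ hold, and the synthesis judgments $\Gamma\vdash_{\Xi;\Sigma}P\Rightarrow K$, $\Gamma\vdash_{\Xi;\Sigma}S\rhd K\Rightarrow K'$, $\Gamma\vdash_{\Xi;\Sigma}R\Rightarrow P$, $\Gamma\vdash_{\Xi;\Sigma}S\rhd A\Rightarrow P$ can be decided (computing the output or failing).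
   Context: CoLF syntax: signatures $\Sigma$ with declarations $a:K$, $c:A$, $r:A=M$ (recursion constants; bodies may refer to recursion constants declared later, all other references are to earlier declarations); contexts $\Gamma::=\cdot\mid\Gamma,x{:}A\mid\Gamma,x\,\hat{:}\,A$; kinds $K::=\mathsf{type}\mid\mathsf{cotype}\mid\Pi x{:}A.K\mid\Pi x\,\hat{:}\,A.K$; types $A::=P\mid\Pi x{:}A_2.A_1\mid\Pi x\,\hat{:}\,A_2.A_1$, $P::=a\cdot S$; terms $M::=R\mid\lambda x.M$, $R::=H\cdot S$, $H::=x\mid c\mid r$; spines $S::=()\mid M;S\mid[y];S$. Hereditary substitution $[N/x]^\tau$ on simple types $\tau::=*\mid\tau_1\to\tau_2$ (erasure $(\Pi x{:}A_2.A_1)^o=A_2^o\to A_1^o$, $(\Pi x\,\hat{:}\,A_2.A_1)^o=*\to A_1^o$, $P^o=*$) and renaming $\{y/x\}$ are as usual for canonical LF, with $([y];S)\rhd^{*\to\tau}(\lambda x.M)=S\rhd^\tau\{y/x\}M$ and substitution for a prepattern argument undefined. Rules. $\Sigma\ \mathsf{sig}$ iff $\vdash_\Sigma\Sigma\ \mathsf{sig}$. $\vdash_\Sigma\Xi\ \mathsf{sig}$: empty is fine; $\Xi,a{:}K$ if $\Xi$ ok and $\vdash_{\Xi;\Sigma}K\Leftarrow\mathsf{kind}$; $\Xi,c{:}A$ if $\Xi$ ok and $A\Leftarrow\mathsf{type}/\mathsf{cotype}$; $\Xi,r{:}A=M$ if $\Xi$ ok, $\vdash_{\Xi;\Sigma}A\Leftarrow\mathsf{type}/\mathsf{cotype}$,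 $A$ consists only of prepattern $\Pi$'s over an atomic type, $M$ is contractive (its head is not a recursion constant), $r$ is guarded in $M$ (every path from the root of $M$, unfolding other recursion constants of $\Sigma$, to an occurrence of $r$ passes through a coinductive constructor whose priority is highest among the constructors on that path; priorities: later-declared type families have higher priority, constructors inherit the priority of their target family, a constructor is coinductive if its target family's kind ends in $\mathsf{cotype}$), and — deferred until all declarations of $\Sigma$ have been checked — $\vdash_{\Xi;\Sigma}M\Leftarrow A$. Contexts: each added $x{:}A$ or $x\,\hat{:}\,A$ needs $A\Leftarrow\mathsf{type}/\mathsf{cotype}$. Kinds: $\mathsf{type},\mathsf{cotype}\Leftarrow\mathsf{kind}$; $\Pi x{:}A.K$ / $\Pi x\,\hat{:}\,A.K$ if $A\Leftarrow\mathsf{type}/\mathsf{cotype}$ and $K\Leftarrow\mathsf{kind}$ in the extended context. Types: $\Pi$'s similarly; $P\Leftarrow\mathsf{type}/\mathsf{cotype}$ if $P\Rightarrow\mathsf{type}$ or $\mathsf{cotype}$; $a\cdot S\Rightarrow K'$ if $a{:}K\in\Xi$ and $S\rhd K\Rightarrow K'$; kind spines: $()\rhd K\Rightarrow K$, $M;S\rhd\Pi x{:}A_2.K$ if $M\Leftarrow A_2$ and $S\rhd[M/x]^{A_2^o}K$, $[y];S\rhd\Pi x\,\hat{:}\,A_2.K$ if $y\,\hat{:}\,A_2'\in\Gamma$, $A_2'=A_2$ and $S\rhd\{y/x\}K$. Terms: $\lambda x.M\Leftarrow\Pi x{:}A_2.A_1$ / $\Pi x\,\hat{:}\,A_2.A_1$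 if $M\Leftarrow A_1$ in $\Gamma,x{:}A_2$ / $\Gamma,x\,\hat{:}\,A_2$; $R\Leftarrow P$ if $R\Rightarrow P'$ and $\Gamma\vdash_\Sigma P'=P$; $x\cdot S\Rightarrow P$ if $x{:}A$ or $x\,\hat{:}\,A$ in $\Gamma$ and $S\rhd A\Rightarrow P$; $c\cdot S\Rightarrow P$ if $c{:}A\in\Xi$ and $S\rhd A\Rightarrow P$; $r\cdot S\Rightarrow P$ if $r{:}A=M\in\Xi$ (or $\in\Sigma$ while checking deferred bodies) and $S\rhd A\Rightarrow P$; type spines analogous to kind spines, ending with $()\rhd P\Rightarrow P$. Type equality: structural on $\Pi$'s, and $a\cdot S=a\cdot S'$ iff $\cdot;|\Gamma|\vdash_\Sigma S=S'$ in the CoLF term equality algorithm, which decides equality of the infinite Böhm-tree unfoldings of rational terms (unfolding $r\cdot S$ with $S$ a prepattern spine to $S\rhd^{A^o}M$, memoising encountered equations and closing a goal when it is a variable renaming of a memoised equation). -}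

module Defs where

-- Variables are well-scoped de Bruijn indices; constants (type
-- families, term constants, recursion constants) are referred to by
-- their position (ℕ, counted from 0 = first declaration) in the
-- signature.

open import Data.Nat using (ℕ; zero; suc; _≤_)
open import Data.Fin using (Fin; zero; suc)
open import Data.List using (List; []; _∷_; _∷ʳ_; length)
open import Data.List.Membership.Propositional using (_∈_)
open import Data.List.Relation.Unary.All using (All)
open import Data.Maybe using (Maybe; just; nothing; _>>=_)
open import Data.Product using (Σ; _×_; _,_; ∃)
open import Data.Sum using (_⊎_)
open import Data.Bool using (Bool; true; false; if_then_else_)
open import Relation.Binary.PropositionalEquality using (_≡_; _≢_)
open import Relation.Nullary using (¬_)

-- heads H ::= x | c | r   (c and r are both `cst i`, distinguished by
-- the declaration found at position i of the signature)
data Head (n : ℕ) : Set where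
  var : Fin n → Head n
  cst : ℕ → Head n

mutual
  data Tm (n : ℕ) : Set where
    lam : Tm (suc n) → Tm n
    app : Head n → Sp n → Tm n

  -- spines S ::= () | M;S | [y];S
  data Sp (n : ℕ) : Set where
    nil : Sp n
    _∷_ : Tm n → Sp n → Sp n
    pv  : Fin n → Sp n → Sp n

-- types A ::= a · S | Π x:A₂.A₁ | Π x ^: A₂.A₁
data Ty (n : ℕ) : Set where
  atom : ℕ → Sp n → Ty n
  pi   : Ty n → Ty (suc n) → Ty n
  pih  : Ty n → Ty (suc n) → Ty n

data Kd (n : ℕ) : Set where
  type   : Kd n
  cotype : Kd n
  pi     : Ty n → Kd (suc n) → Kd n
  pih    : Ty n → Kd (suc n) → Kd n

data Decl : Set where
  fam : Kd 0 → Decl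
  con : Ty 0 → Decl
  rc  : Ty 0 → Tm 0 → Decl

Sig : Set
Sig = List Decl

_‼_ : Sig → ℕ → Maybe Decl
[]      ‼ _     = nothing
(d ∷ _) ‼ zero  = just d
(_ ∷ ds) ‼ suc i = ds ‼ i

data Mode : Set where
  nrm hat : Mode

data Ctx : ℕ → Set where
  ε   : Ctx zero
  _▸_ : ∀ {n} → Ctx n → Mode × Ty n → Ctx (suc n)

Ren : ℕ → ℕ → Set
Ren m n = Fin m → Fin n

lift : ∀ {m n} → Ren m n → Ren (suc m) (suc n)
lift ρ zero    = zero
lift ρ (suc i) = suc (ρ i)

renH : ∀ {m n} → Ren m n → Head m → Head n
renH ρ (var x) = var (ρ x)
renH ρ (cst c) = cst c

mutual
  renTm : ∀ {m n} → Ren m n → Tm m → Tm n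
  renTm ρ (lam M)   = lam (renTm (lift ρ) M)
  renTm ρ (app H S) = app (renH ρ H) (renSp ρ S)

  renSp : ∀ {m n} → Ren m n → Sp m → Sp n
  renSp ρ nil      = nil
  renSp ρ (M ∷ S)  = renTm ρ M ∷ renSp ρ S
  renSp ρ (pv y S) = pv (ρ y) (renSp ρ S)

renTy : ∀ {m n} → Ren m n → Ty m → Ty n
renTy ρ (atom a S) = atom a (renSp ρ S)
renTy ρ (pi A B)   = pi (renTy ρ A) (renTy (lift ρ) B)
renTy ρ (pih A B)  = pih (renTy ρ A) (renTy (lift ρ) B)

renKd : ∀ {m n} → Ren m n → Kd m → Kd n
renKd ρ type      = type
renKd ρ cotype    = cotype
renKd ρ (pi A K)  = pi (renTy ρ A) (renKd (lift ρ) K)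
renKd ρ (pih A K) = pih (renTy ρ A) (renKd (lift ρ) K)

wkTm : ∀ {n} → Tm n → Tm (suc n)
wkTm = renTm suc

wkTy : ∀ {n} → Ty n → Ty (suc n)
wkTy = renTy suc

clTm : ∀ {n} → Tm 0 → Tm n
clTm = renTm (λ ())

clTy : ∀ {n} → Ty 0 → Ty n
clTy = renTy (λ ())

clKd : ∀ {n} → Kd 0 → Kd n
clKd = renKd (λ ())

[_/0] : ∀ {n} → Fin n → Ren (suc n) n
[ y /0] zero    = y
[ y /0] (suc i) = i

data STy : Set where
  ⋆   : STy
  _⇒_ : STy → STy → STy

erase : ∀ {n} → Ty n → STy
erase (atom _ _) = ⋆
erase (pi A B)   = erase A ⇒ erase B
erase (pih A B)  = ⋆ ⇒ erase B

-- Hereditary substitution [N/x]^τ (partial: `nothing` = undefined)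

thick : ∀ {n} → Fin (suc n) → Fin (suc n) → Maybe (Fin n)
thick zero    zero    = nothing
thick zero    (suc y) = just y
thick {suc n} (suc x) zero    = just zero
thick {suc n} (suc x) (suc y) with thick x y
... | just z  = just (suc z)
... | nothing = nothing

mutual
  hsubTm : ∀ {n} → STy → Fin (suc n) → Tm n → Tm (suc n) → Maybe (Tm n)
  hsubTm τ x N (lam M) with hsubTm τ (suc x) (wkTm N) M
  ... | just M' = just (lam M')
  ... | nothing = nothing
  hsubTm τ x N (app (cst c) S) with hsubSp τ x N S
  ... | just S' = just (app (cst c) S')
  ... | nothing = nothing
  hsubTm τ x N (app (var y) S) with thick x y | hsubSp τ x N S
  ... | _       | nothing = nothing
  ... | just y' | just S' = just (app (var y') S')
  ... | nothing | just S' = reduce τ N S'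

  hsubSp : ∀ {n} → STy → Fin (suc n) → Tm n → Sp (suc n) → Maybe (Sp n)
  hsubSp τ x N nil = just nil
  hsubSp τ x N (M ∷ S) with hsubTm τ x N M | hsubSp τ x N S
  ... | just M' | just S' = just (M' ∷ S')
  ... | _       | _       = nothing
  -- substitution for a prepattern argument is undefined
  hsubSp τ x N (pv y S) with thick x y | hsubSp τ x N S
  ... | just y' | just S' = just (pv y' S')
  ... | _       | _       = nothing

  reduce : ∀ {n} → STy → Tm n → Sp n → Maybe (Tm n)
  reduce τ M nil = just M
  reduce (τ₁ ⇒ τ₂) (lam M) (N ∷ S) with hsubTm τ₁ zero N M
  ... | just M' = reduce τ₂ M' S
  ... | nothing = nothing
  reduce (⋆ ⇒ τ₂) (lam M) (pv y S) = reduce τ₂ (renTm [ y /0] M) S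
  reduce _ _ _ = nothing

mutual
  hsubTy : ∀ {n} → STy → Fin (suc n) → Tm n → Ty (suc n) → Maybe (Ty n)
  hsubTy τ x N (atom a S) with hsubSp τ x N S
  ... | just S' = just (atom a S')
  ... | nothing = nothing
  hsubTy τ x N (pi A B) with hsubTy τ x N A | hsubTy τ (suc x) (wkTm N) B
  ... | just A' | just B' = just (pi A' B')
  ... | _       | _       = nothing
  hsubTy τ x N (pih A B) with hsubTy τ x N A | hsubTy τ (suc x) (wkTm N) B
  ... | just A' | just B' = just (pih A' B')
  ... | _       | _       = nothing

hsubKd : ∀ {n} → STy → Fin (suc n) → Tm n → Kd (suc n) → Maybe (Kd n)
hsubKd τ x N type   = just type
hsubKd τ x N cotype = just cotype
hsubKd τ x N (pi A K) with hsubTy τ x N A | hsubKd τ (suc x) (wkTm N) K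
... | just A' | just K' = just (pi A' K')
... | _       | _       = nothing
hsubKd τ x N (pih A K) with hsubTy τ x N A | hsubKd τ (suc x) (wkTm N) K
... | just A' | just K' = just (pih A' K')
... | _       | _       = nothing

data PrepatSp {n : ℕ} : Sp n → Set where
  nil : PrepatSp nil
  pv  : ∀ {y S} → PrepatSp S → PrepatSp (pv y S)

data PrepatTy {n : ℕ} : Ty n → Set where
  atom : ∀ {a S} → PrepatTy (atom a S)
  pih  : ∀ {A B} → PrepatTy B → PrepatTy (pih A B)

data RecHeaded (Σ' : Sig) : ∀ {n} → Tm n → Set where
  lam : ∀ {n} {M : Tm (suc n)} → RecHeaded Σ' M → RecHeaded Σ' (lam M)
  app : ∀ {n r A B} {S : Sp n} → Σ' ‼ r ≡ just (rc A B) →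
        RecHeaded Σ' (app (cst r) S)

Contractive : ∀ {n} → Sig → Tm n → Set
Contractive Σ' M = ¬ RecHeaded Σ' M

data EndsCotype {n : ℕ} : Kd n → Set where
  cotype : EndsCotype cotype
  pi     : ∀ {A K} → EndsCotype K → EndsCotype (pi A K)
  pih    : ∀ {A K} → EndsCotype K → EndsCotype (pih A K)

target : ∀ {n} → Ty n → ℕ
target (atom a _) = a
target (pi _ B)   = target B
target (pih _ B)  = target B

-- priority of a constant: the position of its target family
-- (later-declared families have higher priority)
prio : Sig → ℕ → ℕ
prio Σ' c with Σ' ‼ c
... | just (con A) = target A
... | _            = 0

Coinductive : Sig → ℕ → Set
Coinductive Σ' c = Σ (Ty 0) λ A → Σ (Kd 0) λ K →
  (Σ' ‼ c ≡ just (con A)) × (Σ' ‼ target A ≡ just (fam K)) × EndsCotype K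

IsCon : Sig → ℕ → Set
IsCon Σ' c = Σ (Ty 0) λ A → Σ' ‼ c ≡ just (con A)

IsRec : Sig → ℕ → Set
IsRec Σ' c = Σ (Ty 0) λ A → Σ (Tm 0) λ M → Σ' ‼ c ≡ just (rc A M)

mutual
  data Path (Σ' : Sig) (r : ℕ) : ∀ {n} → Tm n → List ℕ → Set where
    occ     : ∀ {n} {S : Sp n} → Path Σ' r (app (cst r) S) []
    lam     : ∀ {n cs} {M : Tm (suc n)} → Path Σ' r M cs → Path Σ' r (lam M) cs
    argVar  : ∀ {n cs x} {S : Sp n} → PathSp Σ' r S cs →
              Path Σ' r (app (var x) S) cs
    argCon  : ∀ {n cs c} {S : Sp n} → IsCon Σ' c → PathSp Σ' r S cs →
              Path Σ' r (app (cst c) S) (c ∷ cs)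
    argOther : ∀ {n cs c} {S : Sp n} → ¬ IsCon Σ' c → PathSp Σ' r S cs →
              Path Σ' r (app (cst c) S) cs
    unfold  : ∀ {n cs c A M} {S : Sp n} → c ≢ r → Σ' ‼ c ≡ just (rc A M) →
              Path Σ' r M cs → Path Σ' r (app (cst c) S) cs

  data PathSp (Σ' : Sig) (r : ℕ) : ∀ {n} → Sp n → List ℕ → Set where
    here  : ∀ {n cs} {M : Tm n} {S} → Path Σ' r M cs → PathSp Σ' r (M ∷ S) cs
    there : ∀ {n cs} {M : Tm n} {S} → PathSp Σ' r S cs → PathSp Σ' r (M ∷ S) cs
    skip  : ∀ {n cs y} {S : Sp n} → PathSp Σ' r S cs → PathSp Σ' r (pv y S) cs

GoodPath : Sig → List ℕ → Set
GoodPath Σ' cs = Σ ℕ λ c → c ∈ cs × Coinductive Σ' c ×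
                 All (λ c' → prio Σ' c' ≤ prio Σ' c) cs

Guarded : ∀ {n} → Sig → ℕ → Tm n → Set
Guarded Σ' r M = ∀ {cs} → Path Σ' r M cs → GoodPath Σ' cs

-- CoLF term equality algorithm   Δ ; Ψ ⊢_Σ M = N
-- Ψ is the (erased) context, represented by its length n.
-- Δ memoises equations  Ψ' ⊢ M' = N'.

Memo : Set
Memo = List (Σ ℕ λ m → Tm m × Tm m)

Memoised : Memo → ∀ {n} → Tm n → Tm n → Set
Memoised Δ {n} M N = Σ ℕ λ m → Σ (Tm m) λ M' → Σ (Tm m) λ N' →
  ((m , M' , N') ∈ Δ) × Σ (Ren m n) λ ρ → (renTm ρ M' ≡ M) × (renTm ρ N' ≡ N)

Unfolds : Sig → ∀ {n} → Tm n → Tm n → Set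
Unfolds Σ' {n} T T' = Σ ℕ λ r → Σ (Sp n) λ S → Σ (Ty 0) λ A → Σ (Tm 0) λ M →
  (T ≡ app (cst r) S) × (Σ' ‼ r ≡ just (rc A M)) × PrepatSp S ×
  (reduce (erase A) (clTm M) S ≡ just T')

data RecApp (Σ' : Sig) {n : ℕ} : Tm n → Set where
  app : ∀ {r A B} {S : Sp n} → Σ' ‼ r ≡ just (rc A B) → RecApp Σ' (app (cst r) S)

mutual
  data TmEq (Σ' : Sig) (Δ : Memo) : ∀ {n} → Tm n → Tm n → Set where
    lam    : ∀ {n} {M N : Tm (suc n)} → TmEq Σ' Δ M N → TmEq Σ' Δ (lam M) (lam N)
    var    : ∀ {n x} {S S' : Sp n} → SpEq Σ' Δ S S' →
             TmEq Σ' Δ (app (var x) S) (app (var x) S')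
    con    : ∀ {n c} {S S' : Sp n} → IsCon Σ' c → SpEq Σ' Δ S S' →
             TmEq Σ' Δ (app (cst c) S) (app (cst c) S')
    memo   : ∀ {n} {M N : Tm n} → Memoised Δ M N → TmEq Σ' Δ M N
    unfoldL : ∀ {n} {M M' N : Tm n} → Unfolds Σ' M M' →
              TmEq Σ' ((n , M , N) ∷ Δ) M' N → TmEq Σ' Δ M N
    unfoldR : ∀ {n} {M N N' : Tm n} → ¬ RecApp Σ' M → Unfolds Σ' N N' →
              TmEq Σ' ((n , M , N) ∷ Δ) M N' → TmEq Σ' Δ M N

  data SpEq (Σ' : Sig) (Δ : Memo) : ∀ {n} → Sp n → Sp n → Set where
    nil : ∀ {n} → SpEq Σ' Δ {n} nil nil
    _∷_ : ∀ {n} {M M' : Tm n} {S S'} → TmEq Σ' Δ M M' → SpEq Σ' Δ S S' →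
          SpEq Σ' Δ (M ∷ S) (M' ∷ S')
    pv  : ∀ {n y} {S S' : Sp n} → SpEq Σ' Δ S S' → SpEq Σ' Δ (pv y S) (pv y S')

data TyEq (Σ' : Sig) : ∀ {n} → Ctx n → Ty n → Ty n → Set where
  atom : ∀ {n a} {Γ : Ctx n} {S S'} → SpEq Σ' [] S S' →
         TyEq Σ' Γ (atom a S) (atom a S')
  pi   : ∀ {n} {Γ : Ctx n} {A A' B B'} → TyEq Σ' Γ A A' →
         TyEq Σ' (Γ ▸ (nrm , A)) B B' → TyEq Σ' Γ (pi A B) (pi A' B')
  pih  : ∀ {n} {Γ : Ctx n} {A A' B B'} → TyEq Σ' Γ A A' →
         TyEq Σ' (Γ ▸ (hat , A)) B B' → TyEq Σ' Γ (pih A B) (pih A' B')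

-- the signature parameters Ξ;Σ of a judgment, plus a flag recording
-- whether we are checking a deferred recursion-constant body (in which
-- case recursion constants are looked up in Σ instead of Ξ)
record Env : Set where
  constructor env
  field
    Ξ        : Sig
    Σsig     : Sig
    deferred : Bool

recScope : Env → Sig
recScope (env Ξ Σ' d) = if d then Σ' else Ξ

lookupCtx : ∀ {n} → Ctx n → Fin n → Mode × Ty n
lookupCtx (Γ ▸ (μ , A)) zero    = μ , wkTy A
lookupCtx (Γ ▸ b)       (suc x) with lookupCtx Γ x
... | μ , A = μ , wkTy A

module Judgments (E : Env) where
  open Env E

  mutual
    data KindOK {n} (Γ : Ctx n) : Kd n → Set where
      type   : KindOK Γ type
      cotype : KindOK Γ cotype
      pi     : ∀ {A K} → TypeOK Γ A → KindOK (Γ ▸ (nrm , A)) K → KindOK Γ (pi A K)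
      pih    : ∀ {A K} → TypeOK Γ A → KindOK (Γ ▸ (hat , A)) K → KindOK Γ (pih A K)

    data TypeOK {n} (Γ : Ctx n) : Ty n → Set where
      pi      : ∀ {A B} → TypeOK Γ A → TypeOK (Γ ▸ (nrm , A)) B → TypeOK Γ (pi A B)
      pih     : ∀ {A B} → TypeOK Γ A → TypeOK (Γ ▸ (hat , A)) B → TypeOK Γ (pih A B)
      atomTy  : ∀ {a S} → FamSyn Γ a S type → TypeOK Γ (atom a S)
      atomCo  : ∀ {a S} → FamSyn Γ a S cotype → TypeOK Γ (atom a S)

    data FamSyn {n} (Γ : Ctx n) : ℕ → Sp n → Kd n → Set where
      fam : ∀ {a K S K'} → Ξ ‼ a ≡ just (fam K) → KSpine Γ S (clKd K) K' →
            FamSyn Γ a S K'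

    data KSpine {n} (Γ : Ctx n) : Sp n → Kd n → Kd n → Set where
      nil : ∀ {K} → KSpine Γ nil K K
      cns : ∀ {M S A₂ K K₁ K'} → Check Γ M A₂ →
            hsubKd (erase A₂) zero M K ≡ just K₁ → KSpine Γ S K₁ K' →
            KSpine Γ (M ∷ S) (pi A₂ K) K'
      pv  : ∀ {y S A₂ A₂' K K'} → lookupCtx Γ y ≡ (hat , A₂') →
            TyEq Σsig Γ A₂' A₂ → KSpine Γ S (renKd [ y /0] K) K' →
            KSpine Γ (pv y S) (pih A₂ K) K'

    data Check {n} (Γ : Ctx n) : Tm n → Ty n → Set where
      lamPi  : ∀ {M A₂ A₁} → Check (Γ ▸ (nrm , A₂)) M A₁ → Check Γ (lam M) (pi A₂ A₁)
      lamPih : ∀ {M A₂ A₁} → Check (Γ ▸ (hat , A₂)) M A₁ → Check Γ (lam M) (pih A₂ A₁)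
      atom   : ∀ {H S P' a S'} → Syn Γ H S P' → TyEq Σsig Γ P' (atom a S') →
               Check Γ (app H S) (atom a S')

    data Syn {n} (Γ : Ctx n) : Head n → Sp n → Ty n → Set where
      var : ∀ {x S μ A P} → lookupCtx Γ x ≡ (μ , A) → TSpine Γ S A P →
            Syn Γ (var x) S P
      con : ∀ {c S A P} → Ξ ‼ c ≡ just (con A) → TSpine Γ S (clTy A) P →
            Syn Γ (cst c) S P
      rec : ∀ {r S A M P} → recScope E ‼ r ≡ just (rc A M) →
            TSpine Γ S (clTy A) P → Syn Γ (cst r) S P

    data TSpine {n} (Γ : Ctx n) : Sp n → Ty n → Ty n → Set where
      nil : ∀ {a S} → TSpine Γ nil (atom a S) (atom a S)
      cns : ∀ {M S A₂ A A₁ P} → Check Γ M A₂ →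
            hsubTy (erase A₂) zero M A ≡ just A₁ → TSpine Γ S A₁ P →
            TSpine Γ (M ∷ S) (pi A₂ A) P
      pv  : ∀ {y S A₂ A₂' A P} → lookupCtx Γ y ≡ (hat , A₂') →
            TyEq Σsig Γ A₂' A₂ → TSpine Γ S (renTy [ y /0] A) P →
            TSpine Γ (pv y S) (pih A₂ A) P

  data CtxOK : ∀ {n} → Ctx n → Set where
    ε   : CtxOK ε
    _▸_ : ∀ {n} {Γ : Ctx n} {μ A} → CtxOK Γ → TypeOK Γ A → CtxOK (Γ ▸ (μ , A))

open Judgments public

data SigOK (Σ' : Sig) : Sig → Set where
  []  : SigOK Σ' []
  fam : ∀ {Ξ K} → SigOK Σ' Ξ → KindOK (env Ξ Σ' false) ε K →
        SigOK Σ' (Ξ ∷ʳ fam K)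
  con : ∀ {Ξ A} → SigOK Σ' Ξ → TypeOK (env Ξ Σ' false) ε A →
        SigOK Σ' (Ξ ∷ʳ con A)
  rc  : ∀ {Ξ A M} → SigOK Σ' Ξ → TypeOK (env Ξ Σ' false) ε A →
        PrepatTy A → Contractive Σ' M → Guarded Σ' (length Ξ) M →
        -- deferred body check: recursion constants looked up in Σ
        Check (env Ξ Σ' true) ε M A →
        SigOK Σ' (Ξ ∷ʳ rc A M)

SigWF : Sig → Set
SigWF Σ' = SigOK Σ' Σ'

-- Apart from term equality and guardedness, every judgment is syntax-directed and its synthesised
-- output is unique, so it is decided by structural recursion.
--
-- Term equality terminates because every goal reachable from S = S′ equates renamings of subterms
-- of S, S′ and of the bodies of recursion constants.  Up to renaming there are only finitely many
-- such equations, and each unfolding memoises a goal that no memoised equation covers yet, so the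
-- number of uncovered canonical equations strictly decreases.
--
-- Guardedness quantifies over paths through unfoldings, which are walks in the finite graph of
-- these subterms.  A path is good iff it passes a constructor and the family of its highest
-- priority is coinductive, so guardedness reduces to finitely many reachability questions, one
-- for each priority, in the graph extended by a flag recording whether that priority was met.
module Submission where

open import Defs
open import Data.Bool using (Bool; true; false; _∨_; T)
open import Data.Bool.Properties as Boolₚ using (T-∨; T?)
open import Data.Empty using (⊥; ⊥-elim)
open import Data.Fin using (Fin; zero; suc; toℕ; fromℕ<; _↑ˡ_; _↑ʳ_; splitAt)
import Data.Fin.Properties as Finₚ
open import Data.List using (List; []; _∷_; _++_; _∷ʳ_; map; concatMap; allFin; length; filter)
open import Data.List.Extrema.Nat using (argmax; argmax-all; f[⊥]≤f[argmax]; f[xs]≤f[argmax])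
open import Data.List.Membership.Propositional using (_∈_; find; lose)
open import Data.List.Membership.Propositional.Properties
  using (∈-map⁺; ∈-map⁻; ∈-++⁺ˡ; ∈-++⁺ʳ; ∈-++⁻; ∈-concatMap⁺; ∈-allFin; ∈-filter⁺; ∈-filter⁻)
open import Data.List.Properties using (filter-notAll; ∷ʳ-injective)
open import Data.List.Relation.Unary.All as All using (All; []; _∷_)
open import Data.List.Relation.Unary.Any as Any using (Any; here; there)
open import Data.List.Reverse using (Reverse; reverseView; []; _∶_∶ʳ_)
open import Data.Maybe using (just; nothing)
open import Data.Maybe.Properties using (just-injective)
open import Data.Nat as ℕ using (ℕ; zero; suc; _+_; _≤_; _<_; z≤n; s≤s)
import Data.Nat.Properties as ℕₚ
open import Data.Nat.Induction using (<-wellFounded)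
open import Data.Product using (Σ; ∃; _×_; _,_; proj₁; proj₂; uncurry)
import Data.Product.Properties as Σₚ
open import Data.Sum using (_⊎_; inj₁; inj₂; [_,_]′)
import Data.Vec.Functional as Vector
open import Function using (_∘_; id; case_of_; Equivalence)
open import Induction.WellFounded using (Acc; acc)
open import Level using (0ℓ)
open import Relation.Binary.Definitions using (DecidableEquality)
open import Relation.Binary.PropositionalEquality
open import Relation.Nullary using (Dec; yes; no; ¬_; ¬?)
open import Relation.Nullary.Decidable using (map′; _×-dec_; _⊎-dec_; isYes; toWitness; fromWitness)
open import Relation.Unary using (Pred; Decidable; _⊆_)

infix 4 _≟ʰ_ _≟ᵗ_ _≟ˢ_

_≟ʰ_ : ∀ {n} → DecidableEquality (Head n)
var x ≟ʰ var y = map′ (cong var) (λ { refl → refl }) (x Finₚ.≟ y)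
cst c ≟ʰ cst d = map′ (cong cst) (λ { refl → refl }) (c ℕ.≟ d)
var _ ≟ʰ cst _ = no λ ()
cst _ ≟ʰ var _ = no λ ()

mutual
  _≟ᵗ_ : ∀ {n} → DecidableEquality (Tm n)
  lam M ≟ᵗ lam N = map′ (cong lam) (λ { refl → refl }) (M ≟ᵗ N)
  app H S ≟ᵗ app H′ S′ =
    map′ (λ { (refl , refl) → refl }) (λ { refl → refl , refl }) (H ≟ʰ H′ ×-dec S ≟ˢ S′)
  lam _ ≟ᵗ app _ _ = no λ ()
  app _ _ ≟ᵗ lam _ = no λ ()

  _≟ˢ_ : ∀ {n} → DecidableEquality (Sp n)
  nil ≟ˢ nil = yes refl
  (M ∷ S) ≟ˢ (M′ ∷ S′) =
    map′ (λ { (refl , refl) → refl }) (λ { refl → refl , refl }) (M ≟ᵗ M′ ×-dec S ≟ˢ S′)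
  pv y S ≟ˢ pv y′ S′ =
    map′ (λ { (refl , refl) → refl }) (λ { refl → refl , refl }) (y Finₚ.≟ y′ ×-dec S ≟ˢ S′)
  nil ≟ˢ (_ ∷ _) = no λ ()
  nil ≟ˢ pv _ _ = no λ ()
  (_ ∷ _) ≟ˢ nil = no λ ()
  (_ ∷ _) ≟ˢ pv _ _ = no λ ()
  pv _ _ ≟ˢ nil = no λ ()
  pv _ _ ≟ˢ (_ ∷ _) = no λ ()

Term : Set
Term = Σ ℕ Tm

_≟Term_ : DecidableEquality Term
_≟Term_ = Σₚ.≡-dec ℕ._≟_ _≟ᵗ_

‼-functional : ∀ Σ′ {c d d′} → Σ′ ‼ c ≡ just d → Σ′ ‼ c ≡ just d′ → d ≡ d′
‼-functional Σ′ e e′ = just-injective (trans (sym e) e′)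

IsFam : Sig → ℕ → Set
IsFam Σ′ a = ∃ λ K → Σ′ ‼ a ≡ just (fam K)

isFam? : ∀ Σ′ a → Dec (IsFam Σ′ a)
isFam? Σ′ a with Σ′ ‼ a
... | just (fam K)  = yes (K , refl)
... | just (con _)  = no λ { (_ , ()) }
... | just (rc _ _) = no λ { (_ , ()) }
... | nothing       = no λ { (_ , ()) }

isCon? : ∀ Σ′ c → Dec (IsCon Σ′ c)
isCon? Σ′ c with Σ′ ‼ c
... | just (con A)  = yes (A , refl)
... | just (fam _)  = no λ { (_ , ()) }
... | just (rc _ _) = no λ { (_ , ()) }
... | nothing       = no λ { (_ , ()) }

isRec? : ∀ Σ′ c → Dec (IsRec Σ′ c)
isRec? Σ′ c with Σ′ ‼ c
... | just (rc A M) = yes (A , M , refl)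
... | just (fam _)  = no λ { (_ , _ , ()) }
... | just (con _)  = no λ { (_ , _ , ()) }
... | nothing       = no λ { (_ , _ , ()) }

famWith? : ∀ Σ′ a {P : Kd 0 → Set} → (∀ K → Dec (P K)) →
           Dec (∃ λ K → Σ′ ‼ a ≡ just (fam K) × P K)
famWith? Σ′ a {P} P? with isFam? Σ′ a
... | no ¬fam     = no λ (K , e , _) → ¬fam (K , e)
... | yes (K , e) = map′ (λ p → K , e , p) back (P? K)
  where
  back : ∃ (λ K′ → Σ′ ‼ a ≡ just (fam K′) × P K′) → P K
  back (_ , e′ , p) with ‼-functional Σ′ e e′
  ... | refl = p

conWith? : ∀ Σ′ c {P : Ty 0 → Set} → (∀ A → Dec (P A)) →
           Dec (∃ λ A → Σ′ ‼ c ≡ just (con A) × P A)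
conWith? Σ′ c {P} P? with isCon? Σ′ c
... | no ¬con     = no λ (A , e , _) → ¬con (A , e)
... | yes (A , e) = map′ (λ p → A , e , p) back (P? A)
  where
  back : ∃ (λ A′ → Σ′ ‼ c ≡ just (con A′) × P A′) → P A
  back (_ , e′ , p) with ‼-functional Σ′ e e′
  ... | refl = p

recWith? : ∀ Σ′ c {P : Ty 0 → Set} → (∀ A → Dec (P A)) →
           Dec (∃ λ A → ∃ λ M → Σ′ ‼ c ≡ just (rc A M) × P A)
recWith? Σ′ c {P} P? with isRec? Σ′ c
... | no ¬rec         = no λ (A , M , e , _) → ¬rec (A , M , e)
... | yes (A , M , e) = map′ (λ p → A , M , e , p) back (P? A)
  where
  back : ∃ (λ A′ → ∃ λ M′ → Σ′ ‼ c ≡ just (rc A′ M′) × P A′) → P A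
  back (_ , _ , e′ , p) with ‼-functional Σ′ e e′
  ... | refl = p

lift-cong : ∀ {m n} {ρ ρ′ : Ren m n} → ρ ≗ ρ′ → lift ρ ≗ lift ρ′
lift-cong e zero    = refl
lift-cong e (suc i) = cong suc (e i)

lift-∘ : ∀ {k m n} (ρ : Ren m n) (ρ′ : Ren k m) → lift ρ ∘ lift ρ′ ≗ lift (ρ ∘ ρ′)
lift-∘ ρ ρ′ zero    = refl
lift-∘ ρ ρ′ (suc i) = refl

lift-id : ∀ {n} → lift {n} id ≗ id
lift-id zero    = refl
lift-id (suc i) = refl

mutual
  renTm-cong : ∀ {m n} {ρ ρ′ : Ren m n} → ρ ≗ ρ′ → renTm ρ ≗ renTm ρ′
  renTm-cong e (lam M)         = cong lam (renTm-cong (lift-cong e) M)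
  renTm-cong e (app (var x) S) = cong₂ app (cong var (e x)) (renSp-cong e S)
  renTm-cong e (app (cst c) S) = cong (app (cst c)) (renSp-cong e S)

  renSp-cong : ∀ {m n} {ρ ρ′ : Ren m n} → ρ ≗ ρ′ → renSp ρ ≗ renSp ρ′
  renSp-cong e nil      = refl
  renSp-cong e (M ∷ S)  = cong₂ _∷_ (renTm-cong e M) (renSp-cong e S)
  renSp-cong e (pv y S) = cong₂ pv (e y) (renSp-cong e S)

mutual
  renTm-∘ : ∀ {k m n} (ρ : Ren m n) (ρ′ : Ren k m) → renTm ρ ∘ renTm ρ′ ≗ renTm (ρ ∘ ρ′)
  renTm-∘ ρ ρ′ (lam M) =
    cong lam (trans (renTm-∘ (lift ρ) (lift ρ′) M) (renTm-cong (lift-∘ ρ ρ′) M))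
  renTm-∘ ρ ρ′ (app (var x) S) = cong (app (var (ρ (ρ′ x)))) (renSp-∘ ρ ρ′ S)
  renTm-∘ ρ ρ′ (app (cst c) S) = cong (app (cst c)) (renSp-∘ ρ ρ′ S)

  renSp-∘ : ∀ {k m n} (ρ : Ren m n) (ρ′ : Ren k m) → renSp ρ ∘ renSp ρ′ ≗ renSp (ρ ∘ ρ′)
  renSp-∘ ρ ρ′ nil      = refl
  renSp-∘ ρ ρ′ (M ∷ S)  = cong₂ _∷_ (renTm-∘ ρ ρ′ M) (renSp-∘ ρ ρ′ S)
  renSp-∘ ρ ρ′ (pv y S) = cong (pv (ρ (ρ′ y))) (renSp-∘ ρ ρ′ S)

mutual
  renTm-id : ∀ {n} → renTm {n} id ≗ id
  renTm-id (lam M)         = cong lam (trans (renTm-cong lift-id M) (renTm-id M))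
  renTm-id (app (var x) S) = cong (app (var x)) (renSp-id S)
  renTm-id (app (cst c) S) = cong (app (cst c)) (renSp-id S)

  renSp-id : ∀ {n} → renSp {n} id ≗ id
  renSp-id nil      = refl
  renSp-id (M ∷ S)  = cong₂ _∷_ (renTm-id M) (renSp-id S)
  renSp-id (pv y S) = cong (pv y) (renSp-id S)

allRens : ∀ m n → List (Ren m n)
allRens zero    n = (λ ()) ∷ []
allRens (suc m) n = concatMap (λ j → map (j Vector.∷_) (allRens m n)) (allFin n)

allRens-complete : ∀ {m n} (f : Ren m n) → ∃ λ g → g ∈ allRens m n × f ≗ g
allRens-complete {zero}      f = (λ ()) , here refl , λ ()
allRens-complete {suc m} {n} f with allRens-complete (f ∘ suc)
... | g , g∈ , f≗g =
  f zero Vector.∷ g ,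
  ∈-concatMap⁺ (λ j → map (j Vector.∷_) (allRens m n))
    (lose (∈-allFin (f zero)) (∈-map⁺ (f zero Vector.∷_) g∈)) ,
  λ { zero → refl ; (suc i) → f≗g i }

∃Ren? : ∀ {m n} (P : Ren m n → Set) → (∀ {f g} → f ≗ g → P f → P g) →
        (∀ f → Dec (P f)) → Dec (∃ P)
∃Ren? {m} {n} P resp P? = map′ witness complete (Any.any? P? (allRens m n))
  where
  witness : Any P (allRens m n) → ∃ P
  witness a = let f , _ , p = find a in f , p
  complete : ∃ P → Any P (allRens m n)
  complete (f , p) = let g , g∈ , f≗g = allRens-complete f in lose g∈ (resp f≗g p)

mutual
  subterms : ∀ {n} → Tm n → List Term
  subterms {n} (lam M)   = (n , lam M) ∷ subterms M
  subterms {n} (app H S) = (n , app H S) ∷ spSubterms S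

  spSubterms : ∀ {n} → Sp n → List Term
  spSubterms nil      = []
  spSubterms (M ∷ S)  = subterms M ++ spSubterms S
  spSubterms (pv y S) = spSubterms S

subtermsOf : Term → List Term
subtermsOf (_ , T) = subterms T

self∈subterms : ∀ {n} (T : Tm n) → (n , T) ∈ subterms T
self∈subterms (lam M)   = here refl
self∈subterms (app H S) = here refl

SubtermClosed : List Term → Set
SubtermClosed B = ∀ {t u} → t ∈ B → u ∈ subtermsOf t → u ∈ B

mutual
  subterms-closed : ∀ {n} (T : Tm n) → SubtermClosed (subterms T)
  subterms-closed (lam M)   (here refl) u∈ = u∈
  subterms-closed (lam M)   (there t∈)  u∈ = there (subterms-closed M t∈ u∈)
  subterms-closed (app H S) (here refl) u∈ = u∈
  subterms-closed (app H S) (there t∈)  u∈ = there (spSubterms-closed S t∈ u∈)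

  spSubterms-closed : ∀ {n} (S : Sp n) → SubtermClosed (spSubterms S)
  spSubterms-closed (M ∷ S) t∈ u∈ with ∈-++⁻ (subterms M) t∈
  ... | inj₁ t∈M = ∈-++⁺ˡ (subterms-closed M t∈M u∈)
  ... | inj₂ t∈S = ∈-++⁺ʳ (subterms M) (spSubterms-closed S t∈S u∈)
  spSubterms-closed (pv y S) t∈ u∈ = spSubterms-closed S t∈ u∈

++-subtermClosed : ∀ {B C} → SubtermClosed B → SubtermClosed C → SubtermClosed (B ++ C)
++-subtermClosed {B} clB clC t∈ u∈ with ∈-++⁻ B t∈
... | inj₁ t∈B = ∈-++⁺ˡ (clB t∈B u∈)
... | inj₂ t∈C = ∈-++⁺ʳ B (clC t∈C u∈)

bodySubterms : Sig → List Term
bodySubterms []             = []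
bodySubterms (fam _ ∷ Σ′)   = bodySubterms Σ′
bodySubterms (con _ ∷ Σ′)   = bodySubterms Σ′
bodySubterms (rc A M ∷ Σ′)  = subterms M ++ bodySubterms Σ′

bodySubterms-closed : ∀ Σ′ → SubtermClosed (bodySubterms Σ′)
bodySubterms-closed []            ()
bodySubterms-closed (fam _ ∷ Σ′)  = bodySubterms-closed Σ′
bodySubterms-closed (con _ ∷ Σ′)  = bodySubterms-closed Σ′
bodySubterms-closed (rc A M ∷ Σ′) =
  ++-subtermClosed {subterms M} (subterms-closed M) (bodySubterms-closed Σ′)

body∈bodySubterms : ∀ Σ′ {r A M} → Σ′ ‼ r ≡ just (rc A M) → (0 , M) ∈ bodySubterms Σ′
body∈bodySubterms (fam _ ∷ Σ′)  {suc r} e    = body∈bodySubterms Σ′ e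
body∈bodySubterms (con _ ∷ Σ′)  {suc r} e    = body∈bodySubterms Σ′ e
body∈bodySubterms (rc A M ∷ Σ′) {zero}  refl = ∈-++⁺ˡ (self∈subterms M)
body∈bodySubterms (rc A M ∷ Σ′) {suc r} e    = ∈-++⁺ʳ (subterms M) (body∈bodySubterms Σ′ e)

RenamingOf : List Term → ∀ {n} → Tm n → Set
RenamingOf B {n} T = ∃ λ k → ∃ λ (X : Tm k) → (k , X) ∈ B × ∃ λ (ρ : Ren k n) → renTm ρ X ≡ T

Eqn : Set
Eqn = Σ ℕ λ m → Tm m × Tm m

infix 4 _≼_ _≼?_

_≼_ : Eqn → Eqn → Set
(m , M′ , N′) ≼ (n , M , N) = ∃ λ (ρ : Ren m n) → renTm ρ M′ ≡ M × renTm ρ N′ ≡ N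

_≼?_ : ∀ e g → Dec (e ≼ g)
(m , M′ , N′) ≼? (n , M , N) =
  ∃Ren? _ respects λ ρ → renTm ρ M′ ≟ᵗ M ×-dec renTm ρ N′ ≟ᵗ N
  where
  respects : ∀ {ρ ρ′} → ρ ≗ ρ′ →
             renTm ρ M′ ≡ M × renTm ρ N′ ≡ N → renTm ρ′ M′ ≡ M × renTm ρ′ N′ ≡ N
  respects e (p , q) = trans (sym (renTm-cong e M′)) p , trans (sym (renTm-cong e N′)) q

≼-trans : ∀ {e f g} → e ≼ f → f ≼ g → e ≼ g
≼-trans {_ , M₁ , N₁} (ρ , refl , refl) (ρ′ , refl , refl) =
  ρ′ ∘ ρ , sym (renTm-∘ ρ′ ρ M₁) , sym (renTm-∘ ρ′ ρ N₁)

infix 4 _≃_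

_≃_ : Eqn → Eqn → Set
e ≃ g = e ≼ g × g ≼ e

join : ∀ {k₁ k₂ n} → Ren k₁ n → Ren k₂ n → Ren (k₁ + k₂) n
join {k₁} σ₁ σ₂ = [ σ₁ , σ₂ ]′ ∘ splitAt k₁

join-↑ˡ : ∀ {k₁ k₂ n} (σ₁ : Ren k₁ n) (σ₂ : Ren k₂ n) → join σ₁ σ₂ ∘ (_↑ˡ k₂) ≗ σ₁
join-↑ˡ {k₁} {k₂} σ₁ σ₂ i = cong [ σ₁ , σ₂ ]′ (Finₚ.splitAt-↑ˡ k₁ i k₂)

join-↑ʳ : ∀ {k₁ k₂ n} (σ₁ : Ren k₁ n) (σ₂ : Ren k₂ n) → join σ₁ σ₂ ∘ (k₁ ↑ʳ_) ≗ σ₂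
join-↑ʳ {k₁} {k₂} σ₁ σ₂ i = cong [ σ₁ , σ₂ ]′ (Finₚ.splitAt-↑ʳ k₁ k₂ i)

section : ∀ {K n} → Ren (suc K) n → Ren n (suc K)
section f v with Finₚ.any? (λ j → f j Finₚ.≟ v)
... | yes (j , _) = j
... | no _        = zero

section-on-image : ∀ {K n} (f : Ren (suc K) n) x → f (section f (f x)) ≡ f x
section-on-image f x with Finₚ.any? (λ j → f j Finₚ.≟ f x)
... | yes (j , fj≡fx) = fj≡fx
... | no ∄j           = ⊥-elim (∄j (x , refl))

module _ {k₁ k₂} (B₁ : Tm k₁) (B₂ : Tm k₂) where

  canonicalAt : ∀ K → Ren k₁ K → Ren k₂ K → List Eqn
  canonicalAt K e₁ e₂ = map (λ π → K , renTm (π ∘ e₁) B₁ , renTm (π ∘ e₂) B₂) (allRens K K)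

  -- the canonical representative is obtained with π = ρ ∘ f, which f undoes on its image
  canonicalAt-complete :
    ∀ {K n} (e₁ : Ren k₁ K) (e₂ : Ren k₂ K) (f : Ren K n) (ρ : Ren n K) →
    (∀ x → f (ρ (f x)) ≡ f x) → ∀ {σ₁ σ₂} → f ∘ e₁ ≗ σ₁ → f ∘ e₂ ≗ σ₂ →
    ∃ λ C → C ∈ canonicalAt K e₁ e₂ × C ≃ (n , renTm σ₁ B₁ , renTm σ₂ B₂)
  canonicalAt-complete {K} e₁ e₂ f ρ fρf h₁ h₂ with allRens-complete (ρ ∘ f)
  ... | π , π∈ , ρf≗π =
    _ , ∈-map⁺ _ π∈ ,
    (f , expand B₁ e₁ h₁ , expand B₂ e₂ h₂) , (ρ , shrink B₁ e₁ h₁ , shrink B₂ e₂ h₂)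
    where
    expand : ∀ {k} (B : Tm k) (e : Ren k K) {σ} → f ∘ e ≗ σ → renTm f (renTm (π ∘ e) B) ≡ renTm σ B
    expand B e h = trans (renTm-∘ f (π ∘ e) B)
      (renTm-cong (λ i → trans (cong f (sym (ρf≗π (e i)))) (trans (fρf (e i)) (h i))) B)

    shrink : ∀ {k} (B : Tm k) (e : Ren k K) {σ} → f ∘ e ≗ σ → renTm ρ (renTm σ B) ≡ renTm (π ∘ e) B
    shrink B e h =
      trans (renTm-∘ ρ _ B) (renTm-cong (λ i → trans (cong ρ (sym (h i))) (ρf≗π (e i))) B)

  -- an extra variable lets `section` exist when the goal scope is nonempty
  canonicalPair : List Eqn
  canonicalPair = canonicalAt (k₁ + k₂) (_↑ˡ k₂) (k₁ ↑ʳ_)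
               ++ canonicalAt (suc (k₁ + k₂)) (suc ∘ (_↑ˡ k₂)) (suc ∘ (k₁ ↑ʳ_))

  canonicalPair-complete : ∀ {n} (σ₁ : Ren k₁ n) (σ₂ : Ren k₂ n) →
    ∃ λ C → C ∈ canonicalPair × C ≃ (n , renTm σ₁ B₁ , renTm σ₂ B₂)
  canonicalPair-complete {zero} σ₁ σ₂
    with canonicalAt-complete _ _ (join σ₁ σ₂) (λ ()) (λ x → case join σ₁ σ₂ x of λ ())
           (join-↑ˡ σ₁ σ₂) (join-↑ʳ σ₁ σ₂)
  ... | C , C∈ , C≃ = C , ∈-++⁺ˡ C∈ , C≃
  canonicalPair-complete {suc n} σ₁ σ₂
    with canonicalAt-complete _ _ f (section f) (section-on-image f) (join-↑ˡ σ₁ σ₂) (join-↑ʳ σ₁ σ₂)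
    where f = zero Vector.∷ join σ₁ σ₂
  ... | C , C∈ , C≃ = C , ∈-++⁺ʳ (canonicalAt (k₁ + k₂) (_↑ˡ k₂) (k₁ ↑ʳ_)) C∈ , C≃

canonical : List Term → List Eqn
canonical B = concatMap (λ (_ , B₁) → concatMap (λ (_ , B₂) → canonicalPair B₁ B₂) B) B

canonical-complete : ∀ B {n} {M N : Tm n} → RenamingOf B M → RenamingOf B N →
                     ∃ λ C → C ∈ canonical B × C ≃ (n , M , N)
canonical-complete B (k₁ , B₁ , B₁∈ , σ₁ , refl) (k₂ , B₂ , B₂∈ , σ₂ , refl)
  with canonicalPair-complete B₁ B₂ σ₁ σ₂
... | C , C∈ , C≃ =
  C , ∈-concatMap⁺ _ (lose B₁∈ (∈-concatMap⁺ _ (lose B₂∈ C∈))) , C≃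

module _ {A : Set} where

  count∁ : {P : Pred A 0ℓ} → Decidable P → List A → ℕ
  count∁ P? []       = 0
  count∁ P? (x ∷ xs) with P? x
  ... | yes _ = count∁ P? xs
  ... | no _  = suc (count∁ P? xs)

  module _ {P Q : Pred A 0ℓ} (P? : Decidable P) (Q? : Decidable Q) (P⊆Q : P ⊆ Q) where

    count∁-anti : ∀ xs → count∁ Q? xs ≤ count∁ P? xs
    count∁-anti []       = z≤n
    count∁-anti (x ∷ xs) with P? x | Q? x
    ... | yes _ | yes _  = count∁-anti xs
    ... | yes p | no ¬q  = ⊥-elim (¬q (P⊆Q p))
    ... | no _  | yes _  = ℕₚ.m≤n⇒m≤1+n (count∁-anti xs)
    ... | no _  | no _   = s≤s (count∁-anti xs)

    count∁-strict : ∀ {x xs} → x ∈ xs → ¬ P x → Q x → count∁ Q? xs < count∁ P? xs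
    count∁-strict {xs = y ∷ xs} (here refl) ¬p q with P? y | Q? y
    ... | yes p | _      = ⊥-elim (¬p p)
    ... | no _  | no ¬q  = ⊥-elim (¬q q)
    ... | no _  | yes _  = s≤s (count∁-anti xs)
    count∁-strict {xs = y ∷ xs} (there x∈) ¬p q with P? y | Q? y
    ... | yes _ | yes _  = count∁-strict x∈ ¬p q
    ... | yes p | no ¬q  = ⊥-elim (¬q (P⊆Q p))
    ... | no _  | yes _  = ℕₚ.m≤n⇒m≤1+n (count∁-strict x∈ ¬p q)
    ... | no _  | no _   = s≤s (count∁-strict x∈ ¬p q)

prepatSp? : ∀ {n} (S : Sp n) → Dec (PrepatSp S)
prepatSp? nil      = yes nil
prepatSp? (_ ∷ _)  = no λ ()
prepatSp? (pv y S) = map′ pv (λ { (pv p) → p }) (prepatSp? S)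

args : ∀ {n} → Sp n → List (Tm n)
args nil      = []
args (M ∷ S)  = M ∷ args S
args (pv _ S) = args S

args⊆spSubterms : ∀ {n} {M : Tm n} S → M ∈ args S → (n , M) ∈ spSubterms S
args⊆spSubterms (M ∷ S)  (here refl) = ∈-++⁺ˡ (self∈subterms M)
args⊆spSubterms (M ∷ S)  (there M∈)  = ∈-++⁺ʳ (subterms M) (args⊆spSubterms S M∈)
args⊆spSubterms (pv _ S) M∈          = args⊆spSubterms S M∈

reduce-prepat⇒renamingOf : ∀ τ {k n} (X : Tm k) (ρ : Ren k n) {S : Sp n} {T} → PrepatSp S →
                           reduce τ (renTm ρ X) S ≡ just T → RenamingOf (subterms X) T
reduce-prepat⇒renamingOf τ X ρ nil eq = _ , X , self∈subterms X , ρ , just-injective eq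
reduce-prepat⇒renamingOf (⋆ ⇒ τ) (lam X) ρ {pv y S} (pv pp) eq
  with reduce-prepat⇒renamingOf τ X ([ y /0] ∘ lift ρ) pp
         (trans (cong (λ X′ → reduce τ X′ S) (sym (renTm-∘ [ y /0] (lift ρ) X))) eq)
... | k , X′ , X′∈ , σ , refl = k , X′ , there X′∈ , σ , refl
reduce-prepat⇒renamingOf ⋆               X         ρ (pv pp) ()
reduce-prepat⇒renamingOf ((_ ⇒ _) ⇒ _)   X         ρ (pv pp) ()
reduce-prepat⇒renamingOf (⋆ ⇒ _)         (app _ _) ρ (pv pp) ()

module Unfolding (Σ′ : Sig) where

  unfolds-inv : ∀ {n r A M} {S : Sp n} {T} → Σ′ ‼ r ≡ just (rc A M) →
                Unfolds Σ′ (app (cst r) S) T → reduce (erase A) (clTm M) S ≡ just T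
  unfolds-inv e (_ , _ , _ , _ , refl , e′ , _ , red) with ‼-functional Σ′ e e′
  ... | refl = red

  unfolds-functional : ∀ {n} {M T₁ T₂ : Tm n} → Unfolds Σ′ M T₁ → Unfolds Σ′ M T₂ → T₁ ≡ T₂
  unfolds-functional (_ , _ , _ , _ , refl , e , _ , red) u = just-injective (trans (sym red) (unfolds-inv e u))

  unfolds? : ∀ {n} (M : Tm n) → Dec (∃ (Unfolds Σ′ M))
  unfolds? (lam _)         = no λ { (_ , _ , _ , _ , _ , () , _) }
  unfolds? (app (var _) _) = no λ { (_ , _ , _ , _ , _ , () , _) }
  unfolds? (app (cst r) S) with isRec? Σ′ r | prepatSp? S
  ... | no ¬rec | _ = no λ { (_ , _ , _ , _ , _ , refl , e , _) → ¬rec (_ , _ , e) }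
  ... | yes _ | no ¬pp = no λ { (_ , _ , _ , _ , _ , refl , _ , pp , _) → ¬pp pp }
  ... | yes (A , M , e) | yes pp with reduce (erase A) (clTm M) S in red
  ...   | just T  = yes (T , r , S , A , M , refl , e , pp , red)
  ...   | nothing = no λ { (_ , u) → case trans (sym red) (unfolds-inv e u) of λ () }

  unfolds⇒renamingOf : ∀ {B} → (∀ {r A M} → Σ′ ‼ r ≡ just (rc A M) → (0 , M) ∈ B) → SubtermClosed B →
                       ∀ {n} {M T : Tm n} → Unfolds Σ′ M T → RenamingOf B T
  unfolds⇒renamingOf bodies closed (_ , _ , A , M , refl , e , pp , red)
    with reduce-prepat⇒renamingOf (erase A) M (λ ()) pp red
  ... | k , X , X∈ , σ , eq = k , X , closed (bodies e) X∈ , σ , eq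

  recApp? : ∀ {n} (M : Tm n) → Dec (RecApp Σ′ M)
  recApp? (lam _)         = no λ ()
  recApp? (app (var _) _) = no λ ()
  recApp? (app (cst c) S) = map′ (λ (_ , _ , e) → app e) (λ { (app e) → _ , _ , e }) (isRec? Σ′ c)

Covered : Memo → Eqn → Set
Covered Δ g = Any (_≼ g) Δ

covered? : ∀ Δ g → Dec (Covered Δ g)
covered? Δ g = Any.any? (_≼? g) Δ

memoised⇒covered : ∀ {Δ n} {M N : Tm n} → Memoised Δ M N → Covered Δ (n , M , N)
memoised⇒covered (_ , _ , _ , e∈ , e≼g) = lose e∈ e≼g

covered⇒memoised : ∀ {Δ n} {M N : Tm n} → Covered Δ (n , M , N) → Memoised Δ M N
covered⇒memoised c with find c
... | (m , M′ , N′) , e∈ , e≼g = m , M′ , N′ , e∈ , e≼g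

module TermEquality (Σ′ : Sig) (B : List Term) (closed : SubtermClosed B)
                    (bodies : ∀ {r A M} → Σ′ ‼ r ≡ just (rc A M) → (0 , M) ∈ B) where
  open Unfolding Σ′

  Reachable : ∀ {n} → Tm n → Set
  Reachable = RenamingOf B

  reachable-lam : ∀ {n} {T : Tm (suc n)} → Reachable (lam T) → Reachable T
  reachable-lam (k , lam X , X∈ , σ , refl) =
    suc k , X , closed X∈ (there (self∈subterms X)) , lift σ , refl

  renamed-args : ∀ {k n} (σ : Ren k n) S → (∀ {t} → t ∈ spSubterms S → t ∈ B) →
                 All Reachable (args (renSp σ S))
  renamed-args σ nil      S⊆B = []
  renamed-args σ (M ∷ S)  S⊆B =
    (_ , M , S⊆B (∈-++⁺ˡ (self∈subterms M)) , σ , refl) ∷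
    renamed-args σ S (S⊆B ∘ ∈-++⁺ʳ (subterms M))
  renamed-args σ (pv y S) S⊆B = renamed-args σ S S⊆B

  reachable-args : ∀ {n} {H : Head n} {S} → Reachable (app H S) → All Reachable (args S)
  reachable-args (k , app H X , X∈ , σ , refl) = renamed-args σ X (closed X∈ ∘ there)

  measure : Memo → ℕ
  measure Δ = count∁ (covered? Δ) (canonical B)

  measure-decreases : ∀ {Δ n} {M N : Tm n} → ¬ Covered Δ (n , M , N) → Reachable M → Reachable N →
                      measure ((n , M , N) ∷ Δ) < measure Δ
  measure-decreases {Δ} {n} {M} {N} ¬cov rM rN with canonical-complete B rM rN
  ... | C , C∈ , C≼g , g≼C =
    count∁-strict (covered? Δ) (covered? ((n , M , N) ∷ Δ)) there C∈
      (λ cov → ¬cov (Any.map (λ e≼C → ≼-trans e≼C C≼g) cov)) (here g≼C)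

  data RigidEq (Δ : Memo) : ∀ {n} → Tm n → Tm n → Set where
    lam : ∀ {n} {M N : Tm (suc n)} → TmEq Σ′ Δ M N → RigidEq Δ (lam M) (lam N)
    var : ∀ {n x} {S S′ : Sp n} → SpEq Σ′ Δ S S′ → RigidEq Δ (app (var x) S) (app (var x) S′)
    con : ∀ {n c} {S S′ : Sp n} → IsCon Σ′ c → SpEq Σ′ Δ S S′ →
          RigidEq Δ (app (cst c) S) (app (cst c) S′)

  UnfoldL UnfoldR : Memo → ∀ {n} → Tm n → Tm n → Set
  UnfoldL Δ {n} M N = ∃ λ M′ → Unfolds Σ′ M M′ × TmEq Σ′ ((n , M , N) ∷ Δ) M′ N
  UnfoldR Δ {n} M N = ¬ RecApp Σ′ M × ∃ λ N′ → Unfolds Σ′ N N′ × TmEq Σ′ ((n , M , N) ∷ Δ) M N′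

  NonMemoEq : Memo → ∀ {n} → Tm n → Tm n → Set
  NonMemoEq Δ M N = RigidEq Δ M N ⊎ UnfoldL Δ M N ⊎ UnfoldR Δ M N

  nonMemo⇒tmEq : ∀ {Δ n} {M N : Tm n} → NonMemoEq Δ M N → TmEq Σ′ Δ M N
  nonMemo⇒tmEq (inj₁ (lam eq))                    = lam eq
  nonMemo⇒tmEq (inj₁ (var eq))                    = var eq
  nonMemo⇒tmEq (inj₁ (con c eq))                  = con c eq
  nonMemo⇒tmEq (inj₂ (inj₁ (_ , u , eq)))         = unfoldL u eq
  nonMemo⇒tmEq (inj₂ (inj₂ (¬rec , _ , u , eq))) = unfoldR ¬rec u eq

  tmEq⇒nonMemo : ∀ {Δ n} {M N : Tm n} → ¬ Covered Δ (n , M , N) → TmEq Σ′ Δ M N → NonMemoEq Δ M N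
  tmEq⇒nonMemo ¬cov (lam eq)             = inj₁ (lam eq)
  tmEq⇒nonMemo ¬cov (var eq)             = inj₁ (var eq)
  tmEq⇒nonMemo ¬cov (con c eq)           = inj₁ (con c eq)
  tmEq⇒nonMemo ¬cov (memo m)             = ⊥-elim (¬cov (memoised⇒covered m))
  tmEq⇒nonMemo ¬cov (unfoldL u eq)       = inj₂ (inj₁ (_ , u , eq))
  tmEq⇒nonMemo ¬cov (unfoldR ¬rec u eq)  = inj₂ (inj₂ (¬rec , _ , u , eq))

  -- well-founded recursion on the measure, which every unfolding decreases
  mutual
    tmEq? : ∀ Δ → Acc _<_ (measure Δ) → ∀ {n} (M N : Tm n) → Reachable M → Reachable N →
            Dec (TmEq Σ′ Δ M N)
    tmEq? Δ a {n} M N rM rN with covered? Δ (n , M , N)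
    ... | yes cov = yes (memo (covered⇒memoised cov))
    ... | no ¬cov = map′ nonMemo⇒tmEq (tmEq⇒nonMemo ¬cov)
      (rigidEq? Δ a M N rM rN ⊎-dec unfoldL? Δ a M N rM rN ¬cov ⊎-dec unfoldR? Δ a M N rM rN ¬cov)

    unfoldL? : ∀ Δ → Acc _<_ (measure Δ) → ∀ {n} (M N : Tm n) → Reachable M → Reachable N →
               ¬ Covered Δ (n , M , N) → Dec (UnfoldL Δ M N)
    unfoldL? Δ (acc rs) M N rM rN ¬cov with unfolds? M
    ... | no ∄u = no λ (M′ , u , _) → ∄u (M′ , u)
    ... | yes (M′ , u) =
      map′ (λ eq → M′ , u , eq)
           (λ (_ , u′ , eq) → subst (λ X → TmEq Σ′ _ X N) (unfolds-functional u′ u) eq)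
        (tmEq? _ (rs (measure-decreases ¬cov rM rN)) M′ N (unfolds⇒renamingOf bodies closed u) rN)

    unfoldR? : ∀ Δ → Acc _<_ (measure Δ) → ∀ {n} (M N : Tm n) → Reachable M → Reachable N →
               ¬ Covered Δ (n , M , N) → Dec (UnfoldR Δ M N)
    unfoldR? Δ (acc rs) M N rM rN ¬cov with recApp? M | unfolds? N
    ... | yes ra  | _            = no λ (¬ra , _) → ¬ra ra
    ... | no ¬ra  | no ∄u        = no λ (_ , N′ , u , _) → ∄u (N′ , u)
    ... | no ¬ra  | yes (N′ , u) =
      map′ (λ eq → ¬ra , N′ , u , eq)
           (λ (_ , _ , u′ , eq) → subst (TmEq Σ′ _ M) (unfolds-functional u′ u) eq)
        (tmEq? _ (rs (measure-decreases ¬cov rM rN)) M N′ rM (unfolds⇒renamingOf bodies closed u))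

    rigidEq? : ∀ Δ → Acc _<_ (measure Δ) → ∀ {n} (M N : Tm n) → Reachable M → Reachable N →
               Dec (RigidEq Δ M N)
    rigidEq? Δ a (lam M) (lam N) rM rN =
      map′ lam (λ { (lam eq) → eq }) (tmEq? Δ a M N (reachable-lam rM) (reachable-lam rN))
    rigidEq? Δ a (app (var x) S) (app (var y) S′) rM rN with x Finₚ.≟ y
    ... | no x≢y  = no λ { (var _) → x≢y refl }
    ... | yes refl =
      map′ var (λ { (var eq) → eq }) (spEq? Δ a S S′ (reachable-args rM) (reachable-args rN))
    rigidEq? Δ a (app (cst c) S) (app (cst d) S′) rM rN with c ℕ.≟ d
    ... | no c≢d  = no λ { (con _ _) → c≢d refl }
    ... | yes refl =
      map′ (λ (ic , eq) → con ic eq) (λ { (con ic eq) → ic , eq })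
        (isCon? Σ′ c ×-dec spEq? Δ a S S′ (reachable-args rM) (reachable-args rN))
    rigidEq? Δ a (lam _)         (app _ _)       rM rN = no λ ()
    rigidEq? Δ a (app _ _)       (lam _)         rM rN = no λ ()
    rigidEq? Δ a (app (var _) _) (app (cst _) _) rM rN = no λ ()
    rigidEq? Δ a (app (cst _) _) (app (var _) _) rM rN = no λ ()

    spEq? : ∀ Δ → Acc _<_ (measure Δ) → ∀ {n} (S S′ : Sp n) → All Reachable (args S) →
            All Reachable (args S′) → Dec (SpEq Σ′ Δ S S′)
    spEq? Δ a nil nil _ _ = yes nil
    spEq? Δ a (M ∷ S) (M′ ∷ S′) (rM ∷ rS) (rM′ ∷ rS′) =
      map′ (λ (eq , eqs) → eq ∷ eqs) (λ { (eq ∷ eqs) → eq , eqs })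
        (tmEq? Δ a M M′ rM rM′ ×-dec spEq? Δ a S S′ rS rS′)
    spEq? Δ a (pv y S) (pv y′ S′) rS rS′ with y Finₚ.≟ y′
    ... | no y≢y′ = no λ { (pv _) → y≢y′ refl }
    ... | yes refl = map′ pv (λ { (pv eqs) → eqs }) (spEq? Δ a S S′ rS rS′)
    spEq? Δ a nil      (_ ∷ _)  _ _ = no λ ()
    spEq? Δ a nil      (pv _ _) _ _ = no λ ()
    spEq? Δ a (_ ∷ _)  nil      _ _ = no λ ()
    spEq? Δ a (_ ∷ _)  (pv _ _) _ _ = no λ ()
    spEq? Δ a (pv _ _) nil      _ _ = no λ ()
    spEq? Δ a (pv _ _) (_ ∷ _)  _ _ = no λ ()

spineEq? : ∀ Σ′ {n} (S S′ : Sp n) → Dec (SpEq Σ′ [] S S′)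
spineEq? Σ′ S S′ =
  spEq? [] (<-wellFounded _) S S′ (initial S ∈-++⁺ˡ) (initial S′ (∈-++⁺ʳ (spSubterms S) ∘ ∈-++⁺ˡ))
  where
  B = spSubterms S ++ spSubterms S′ ++ bodySubterms Σ′
  open TermEquality Σ′ B
    (++-subtermClosed {spSubterms S} (spSubterms-closed S)
      (++-subtermClosed {spSubterms S′} (spSubterms-closed S′) (bodySubterms-closed Σ′)))
    (∈-++⁺ʳ (spSubterms S) ∘ ∈-++⁺ʳ (spSubterms S′) ∘ body∈bodySubterms Σ′)
  initial : ∀ S₀ → (∀ {t} → t ∈ spSubterms S₀ → t ∈ B) → All Reachable (args S₀)
  initial S₀ S₀⊆B = subst (All Reachable ∘ args) (renSp-id S₀) (renamed-args id S₀ S₀⊆B)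

module Reachability {Node : Set} (_≟_ : DecidableEquality Node)
  (Edge : Node → Node → Set) (next : Node → List Node)
  (next-sound : ∀ {s t} → t ∈ next s → Edge s t) (next-complete : ∀ {s t} → Edge s t → t ∈ next s)
  (Goal : Pred Node 0ℓ) (goal? : Decidable Goal) where

  open import Data.List.Membership.DecPropositional _≟_ using (_∈?_)

  data Walk (U : List Node) : Node → Set where
    done : ∀ {s} → Goal s → Walk U s
    step : ∀ {s t} → Edge s t → t ∈ U → Walk U t → Walk U s

  _∖_ : List Node → Node → List Node
  U ∖ t = filter (λ s → ¬? (s ≟ t)) U

  ∖-⊆ : ∀ {t U s} → s ∈ U ∖ t → s ∈ U
  ∖-⊆ {t} {U} s∈ = proj₁ (∈-filter⁻ (λ s → ¬? (s ≟ t)) {xs = U} s∈)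

  ∖-shorter : ∀ {t U} → t ∈ U → length (U ∖ t) < length U
  ∖-shorter {t} {U} t∈ =
    filter-notAll (λ s → ¬? (s ≟ t)) U (Any.map (λ t≡s s≢t → s≢t (sym t≡s)) t∈)

  widen : ∀ {U V s} → (∀ {x} → x ∈ U → x ∈ V) → Walk U s → Walk V s
  widen U⊆V (done g)      = done g
  widen U⊆V (step e t∈ w) = step e (U⊆V t∈) (widen U⊆V w)

  after-last : ∀ {U} t {s} → Walk U s → Walk (U ∖ t) s ⊎ Walk (U ∖ t) t
  after-last t (done g) = inj₁ (done g)
  after-last t (step {t = u} e u∈ w) with after-last t w
  ... | inj₂ w′ = inj₂ w′
  ... | inj₁ w′ with u ≟ t
  ...   | yes refl = inj₂ w′
  ...   | no u≢t   = inj₁ (step e (∈-filter⁺ (λ s → ¬? (s ≟ t)) u∈ u≢t) w′)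

  without-revisits : ∀ {U t} → Walk U t → Walk (U ∖ t) t
  without-revisits {t = t} w with after-last t w
  ... | inj₁ w′ = w′
  ... | inj₂ w′ = w′

  -- Each recursive call removes the next node t from U: a walk from t need not revisit t.
  walk? : ∀ U s → Dec (Walk U s)
  walk? U = go U (<-wellFounded _)
    where
    go : ∀ U → Acc _<_ (length U) → ∀ s → Dec (Walk U s)
    go U (acc rs) s with goal? s
    ... | yes g = yes (done g)
    ... | no ¬g = map′ fromAny toAny (Any.any? continue? (next s))
      where
      Continue : Node → Set
      Continue t = t ∈ U × Walk (U ∖ t) t
      continue? : ∀ t → Dec (Continue t)
      continue? t with t ∈? U
      ... | no t∉  = no λ (t∈ , _) → t∉ t∈
      ... | yes t∈ = map′ (t∈ ,_) (λ (_ , w) → w) (go (U ∖ t) (rs (∖-shorter t∈)) t)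
      fromAny : Any Continue (next s) → Walk U s
      fromAny a = let t , t∈next , t∈ , w = find a in step (next-sound t∈next) t∈ (widen ∖-⊆ w)
      toAny : Walk U s → Any Continue (next s)
      toAny (done g)      = ⊥-elim (¬g g)
      toAny (step e t∈ w) = lose (next-complete e) (t∈ , without-revisits w)

when : ∀ {P : Set} {A : Set} → Dec P → List A → List A
when (yes _) xs = xs
when (no _)  _  = []

∈-when⁻ : ∀ {P A : Set} (d : Dec P) {x : A} {xs} → x ∈ when d xs → P × x ∈ xs
∈-when⁻ (yes p) x∈ = p , x∈

∈-when⁺ : ∀ {P A : Set} (d : Dec P) {x : A} {xs} → P → x ∈ xs → x ∈ when d xs
∈-when⁺ (yes _) p x∈ = x∈
∈-when⁺ (no ¬p) p x∈ = ⊥-elim (¬p p)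

arg⇒pathSp : ∀ {Σ′ r n cs} {S : Sp n} {M} → M ∈ args S → Path Σ′ r M cs → PathSp Σ′ r S cs
arg⇒pathSp {S = M ∷ S}  (here refl) p = here p
arg⇒pathSp {S = _ ∷ S}  (there M∈)  p = there (arg⇒pathSp M∈ p)
arg⇒pathSp {S = pv _ S} M∈          p = skip (arg⇒pathSp M∈ p)

module PathSearch (Σ′ : Sig) (r : ℕ) {Allowed Hit : Pred ℕ 0ℓ}
                  (allowed? : Decidable Allowed) (hit? : Decidable Hit) where

  Marked : Bool → List ℕ → Set
  Marked b cs = T b ⊎ Any Hit cs

  marked-∷⁻ : ∀ {b c cs} → Marked b (c ∷ cs) → Marked (b ∨ isYes (hit? c)) cs
  marked-∷⁻ {b} {c} (inj₁ tb) = inj₁ (Equivalence.from (T-∨ {b} {isYes (hit? c)}) (inj₁ tb))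
  marked-∷⁻ {b} {c} (inj₂ (here h)) =
    inj₁ (Equivalence.from (T-∨ {b} {isYes (hit? c)}) (inj₂ (fromWitness h)))
  marked-∷⁻ (inj₂ (there hs)) = inj₂ hs

  marked-∷⁺ : ∀ {b c cs} → Marked (b ∨ isYes (hit? c)) cs → Marked b (c ∷ cs)
  marked-∷⁺ {b} (inj₁ t) with Equivalence.to (T-∨ {b}) t
  ... | inj₁ tb = inj₁ tb
  ... | inj₂ th = inj₂ (here (toWitness th))
  marked-∷⁺ (inj₂ hs) = inj₂ (there hs)

  MarkedPath : ∀ {n} → Bool → Tm n → Set
  MarkedPath b M = ∃ λ cs → Path Σ′ r M cs × All Allowed cs × Marked b cs

  -- the flag of a node records whether a Hit constructor has been passed
  Node : Set
  Node = Term × Bool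

  data Edge : Node → Node → Set where
    lam      : ∀ {n b} {M : Tm (suc n)} → Edge ((n , lam M) , b) ((suc n , M) , b)
    argVar   : ∀ {n b x M} {S : Sp n} → M ∈ args S → Edge ((n , app (var x) S) , b) ((n , M) , b)
    argCon   : ∀ {n b c M} {S : Sp n} → IsCon Σ′ c → Allowed c → M ∈ args S →
               Edge ((n , app (cst c) S) , b) ((n , M) , b ∨ isYes (hit? c))
    argOther : ∀ {n b c M} {S : Sp n} → ¬ IsCon Σ′ c → M ∈ args S →
               Edge ((n , app (cst c) S) , b) ((n , M) , b)
    unfold   : ∀ {n b c A M} {S : Sp n} → c ≢ r → Σ′ ‼ c ≡ just (rc A M) →
               Edge ((n , app (cst c) S) , b) ((0 , M) , b)

  argNodes : ∀ {n} → Sp n → Bool → List Node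
  argNodes {n} S b = map (λ M → (n , M) , b) (args S)

  bodyNode : ∀ {c} → Dec (IsRec Σ′ c) → Bool → List Node
  bodyNode (yes (_ , M , _)) b = ((0 , M) , b) ∷ []
  bodyNode (no _)            b = []

  next : Node → List Node
  next ((n , lam M) , b)         = ((suc n , M) , b) ∷ []
  next ((n , app (var x) S) , b) = argNodes S b
  next ((n , app (cst c) S) , b) =
       when (isCon? Σ′ c ×-dec allowed? c) (argNodes S (b ∨ isYes (hit? c)))
    ++ when (¬? (isCon? Σ′ c)) (argNodes S b)
    ++ when (¬? (c ℕ.≟ r)) (bodyNode (isRec? Σ′ c) b)

  ∈-argNodes⁻ : ∀ {n} (S : Sp n) {b t} → t ∈ argNodes S b → ∃ λ M → M ∈ args S × t ≡ ((n , M) , b)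
  ∈-argNodes⁻ S t∈ = ∈-map⁻ _ t∈

  ∈-bodyNode⁻ : ∀ {c b t} (d : Dec (IsRec Σ′ c)) → t ∈ bodyNode d b →
                ∃ λ A → ∃ λ M → Σ′ ‼ c ≡ just (rc A M) × t ≡ ((0 , M) , b)
  ∈-bodyNode⁻ (yes (A , M , e)) (here refl) = A , M , e , refl

  ∈-bodyNode⁺ : ∀ {c b A M} (d : Dec (IsRec Σ′ c)) → Σ′ ‼ c ≡ just (rc A M) →
                ((0 , M) , b) ∈ bodyNode d b
  ∈-bodyNode⁺ (yes (_ , _ , e′)) e with ‼-functional Σ′ e e′
  ... | refl = here refl
  ∈-bodyNode⁺ (no ¬rec) e = ⊥-elim (¬rec (_ , _ , e))

  next-sound : ∀ {s t} → t ∈ next s → Edge s t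
  next-sound {(_ , lam M) , _} (here refl) = lam
  next-sound {(_ , app (var x) S) , _} t∈ with ∈-argNodes⁻ S t∈
  ... | M , M∈ , refl = argVar M∈
  next-sound {(_ , app (cst c) S) , b} t∈ with ∈-++⁻ (when (isCon? Σ′ c ×-dec allowed? c) _) t∈
  ... | inj₁ t∈₁ with ∈-when⁻ (isCon? Σ′ c ×-dec allowed? c) t∈₁
  ...   | (ic , a) , t∈′ with ∈-argNodes⁻ S t∈′
  ...     | M , M∈ , refl = argCon ic a M∈
  next-sound {(_ , app (cst c) S) , b} t∈ | inj₂ t∈₂ with ∈-++⁻ (when (¬? (isCon? Σ′ c)) _) t∈₂
  ... | inj₁ t∈₁ with ∈-when⁻ (¬? (isCon? Σ′ c)) t∈₁
  ...   | ¬ic , t∈′ with ∈-argNodes⁻ S t∈′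
  ...     | M , M∈ , refl = argOther ¬ic M∈
  next-sound {(_ , app (cst c) S) , b} t∈ | inj₂ t∈₂ | inj₂ t∈₃ with ∈-when⁻ (¬? (c ℕ.≟ r)) t∈₃
  ... | c≢r , t∈′ with ∈-bodyNode⁻ (isRec? Σ′ c) t∈′
  ...   | A , M , e , refl = unfold c≢r e

  next-complete : ∀ {s t} → Edge s t → t ∈ next s
  next-complete lam = here refl
  next-complete (argVar M∈) = ∈-map⁺ _ M∈
  next-complete (argCon {c = c} ic a M∈) =
    ∈-++⁺ˡ (∈-when⁺ (isCon? Σ′ c ×-dec allowed? c) (ic , a) (∈-map⁺ _ M∈))
  next-complete (argOther {c = c} ¬ic M∈) =
    ∈-++⁺ʳ (when (isCon? Σ′ c ×-dec allowed? c) _)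
      (∈-++⁺ˡ (∈-when⁺ (¬? (isCon? Σ′ c)) ¬ic (∈-map⁺ _ M∈)))
  next-complete (unfold {c = c} c≢r e) =
    ∈-++⁺ʳ (when (isCon? Σ′ c ×-dec allowed? c) _) (∈-++⁺ʳ (when (¬? (isCon? Σ′ c)) _)
      (∈-when⁺ (¬? (c ℕ.≟ r)) c≢r (∈-bodyNode⁺ (isRec? Σ′ c) e)))

  data Occurrence {n : ℕ} : Tm n → Set where
    occ : ∀ {S} → Occurrence (app (cst r) S)

  Goal : Pred Node 0ℓ
  Goal ((_ , X) , b) = Occurrence X × T b

  goal? : Decidable Goal
  goal? ((_ , lam _) , b)         = no λ ()
  goal? ((_ , app (var _) _) , b) = no λ ()
  goal? ((_ , app (cst c) S) , b) =
    map′ (λ { (refl , tb) → occ , tb }) (λ { (occ , tb) → refl , tb }) (c ℕ.≟ r ×-dec T? b)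

  open Reachability (Σₚ.≡-dec _≟Term_ Boolₚ._≟_) Edge next next-sound next-complete Goal goal?

  universe : List Term → List Node
  universe B = map (_, false) B ++ map (_, true) B

  ∈-universe : ∀ {B t} b → t ∈ B → (t , b) ∈ universe B
  ∈-universe         false t∈ = ∈-++⁺ˡ (∈-map⁺ (_, false) t∈)
  ∈-universe {B = B} true  t∈ = ∈-++⁺ʳ (map (_, false) B) (∈-map⁺ (_, true) t∈)

  walk⇒markedPath : ∀ {U n b} {M : Tm n} → Walk U ((n , M) , b) → MarkedPath b M
  walk⇒markedPath (done (occ , tb)) = [] , occ , [] , inj₁ tb
  walk⇒markedPath (step lam _ w) with walk⇒markedPath w
  ... | cs , p , al , mk = cs , lam p , al , mk
  walk⇒markedPath (step (argVar N∈) _ w) with walk⇒markedPath w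
  ... | cs , p , al , mk = cs , argVar (arg⇒pathSp N∈ p) , al , mk
  walk⇒markedPath (step (argCon ic a N∈) _ w) with walk⇒markedPath w
  ... | cs , p , al , mk = _ ∷ cs , argCon ic (arg⇒pathSp N∈ p) , a ∷ al , marked-∷⁺ mk
  walk⇒markedPath (step (argOther ¬ic N∈) _ w) with walk⇒markedPath w
  ... | cs , p , al , mk = cs , argOther ¬ic (arg⇒pathSp N∈ p) , al , mk
  walk⇒markedPath (step (unfold c≢r e) _ w) with walk⇒markedPath w
  ... | cs , p , al , mk = cs , unfold c≢r e p , al , mk

  module _ (B : List Term) (closed : SubtermClosed B)
           (bodies : ∀ {c A M} → Σ′ ‼ c ≡ just (rc A M) → (0 , M) ∈ B) where

    private
      U = universe B
      ∈U = ∈-universe {B}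

    mutual
      path⇒walk : ∀ {n b cs} {M : Tm n} → Path Σ′ r M cs → All Allowed cs → Marked b cs →
               (n , M) ∈ B → Walk U ((n , M) , b)
      path⇒walk occ [] (inj₁ tb) M∈ = done (occ , tb)
      path⇒walk {b = b} (lam {M = M} p) al mk M∈ =
        step lam (∈U b M′∈) (path⇒walk p al mk M′∈)
        where M′∈ = closed M∈ (there (self∈subterms M))
      path⇒walk (argVar {S = S} ps) al mk M∈
        with pathSp⇒walk ps al mk (closed M∈ ∘ there ∘ args⊆spSubterms S)
      ... | _ , N∈ , N∈B , w = step (argVar N∈) N∈B w
      path⇒walk (argCon {S = S} ic ps) (a ∷ al) mk M∈
        with pathSp⇒walk ps al (marked-∷⁻ mk) (closed M∈ ∘ there ∘ args⊆spSubterms S)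
      ... | _ , N∈ , N∈B , w = step (argCon ic a N∈) N∈B w
      path⇒walk (argOther {S = S} ¬ic ps) al mk M∈
        with pathSp⇒walk ps al mk (closed M∈ ∘ there ∘ args⊆spSubterms S)
      ... | _ , N∈ , N∈B , w = step (argOther ¬ic N∈) N∈B w
      path⇒walk {b = b} (unfold c≢r e p) al mk M∈ =
        step (unfold c≢r e) (∈U b (bodies e)) (path⇒walk p al mk (bodies e))

      pathSp⇒walk : ∀ {n b cs} {S : Sp n} → PathSp Σ′ r S cs → All Allowed cs → Marked b cs →
                 (∀ {N} → N ∈ args S → (n , N) ∈ B) →
                 ∃ λ N → N ∈ args S × ((n , N) , b) ∈ U × Walk U ((n , N) , b)
      pathSp⇒walk {b = b} (here p) al mk S⊆B =
        _ , here refl , ∈U b (S⊆B (here refl)) , path⇒walk p al mk (S⊆B (here refl))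
      pathSp⇒walk (there ps) al mk S⊆B with pathSp⇒walk ps al mk (S⊆B ∘ there)
      ... | N , N∈ , N∈U , w = N , there N∈ , N∈U , w
      pathSp⇒walk (skip ps) al mk S⊆B = pathSp⇒walk ps al mk S⊆B

  markedPath? : ∀ {n} (M : Tm n) b → Dec (MarkedPath b M)
  markedPath? {n} M b =
    map′ walk⇒markedPath
         (λ (_ , p , al , mk) → path⇒walk B closed bodies p al mk (∈-++⁺ˡ (self∈subterms M)))
      (walk? (universe B) ((n , M) , b))
    where
    B = subterms M ++ bodySubterms Σ′
    closed = ++-subtermClosed {subterms M} (subterms-closed M) (bodySubterms-closed Σ′)
    bodies : ∀ {c A M′} → Σ′ ‼ c ≡ just (rc A M′) → (0 , M′) ∈ B
    bodies = ∈-++⁺ʳ (subterms M) ∘ body∈bodySubterms Σ′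

‼-bound : ∀ Σ′ {c d} → Σ′ ‼ c ≡ just d → c < length Σ′
‼-bound (_ ∷ Σ′) {zero}  e = s≤s z≤n
‼-bound (_ ∷ Σ′) {suc c} e = s≤s (‼-bound Σ′ e)

prio-con : ∀ Σ′ {c A} → Σ′ ‼ c ≡ just (con A) → prio Σ′ c ≡ target A
prio-con Σ′ {c} e with Σ′ ‼ c
prio-con Σ′ refl | just (con A) = refl

mutual
  path-cons : ∀ {Σ′ r n cs} {M : Tm n} → Path Σ′ r M cs → All (IsCon Σ′) cs
  path-cons occ             = []
  path-cons (lam p)         = path-cons p
  path-cons (argVar ps)     = pathSp-cons ps
  path-cons (argCon ic ps)  = ic ∷ pathSp-cons ps
  path-cons (argOther _ ps) = pathSp-cons ps
  path-cons (unfold _ _ p)  = path-cons p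

  pathSp-cons : ∀ {Σ′ r n cs} {S : Sp n} → PathSp Σ′ r S cs → All (IsCon Σ′) cs
  pathSp-cons (here p)   = path-cons p
  pathSp-cons (there ps) = pathSp-cons ps
  pathSp-cons (skip ps)  = pathSp-cons ps

endsCotype? : ∀ {n} (K : Kd n) → Dec (EndsCotype K)
endsCotype? type      = no λ ()
endsCotype? cotype    = yes cotype
endsCotype? (pi A K)  = map′ pi (λ { (pi e) → e }) (endsCotype? K)
endsCotype? (pih A K) = map′ pih (λ { (pih e) → e }) (endsCotype? K)

CoinductiveFam : Sig → ℕ → Set
CoinductiveFam Σ′ a = ∃ λ K → Σ′ ‼ a ≡ just (fam K) × EndsCotype K

coinductiveFam? : ∀ Σ′ a → Dec (CoinductiveFam Σ′ a)
coinductiveFam? Σ′ a = famWith? Σ′ a endsCotype?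

PeakPath : Sig → ℕ → ∀ {n} → Tm n → ℕ → Set
PeakPath Σ′ r M p =
  ∃ λ cs → Path Σ′ r M cs × All (λ c → prio Σ′ c ≤ p) cs × Any (λ c → prio Σ′ c ≡ p) cs

peakPath? : ∀ Σ′ r {n} (M : Tm n) p → Dec (PeakPath Σ′ r M p)
peakPath? Σ′ r M p =
  map′ (λ { (cs , path , al , inj₂ hit) → cs , path , al , hit })
       (λ (cs , path , al , hit) → cs , path , al , inj₂ hit)
       (markedPath? M false)
  where open PathSearch Σ′ r (λ c → prio Σ′ c ℕ.≤? p) (λ c → prio Σ′ c ℕ.≟ p)

barePath? : ∀ Σ′ r {n} (M : Tm n) → Dec (Path Σ′ r M [])
barePath? Σ′ r M =
  map′ (λ { ([] , path , [] , _) → path }) (λ path → [] , path , [] , inj₁ _) (markedPath? M true)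
  where open PathSearch Σ′ r {λ _ → ⊥} {λ _ → ⊥} (λ _ → no id) (λ _ → no id)

goodPath⇒coinductive : ∀ {Σ′ cs p} → GoodPath Σ′ cs → All (λ c → prio Σ′ c ≤ p) cs →
                       Any (λ c → prio Σ′ c ≡ p) cs → CoinductiveFam Σ′ p
goodPath⇒coinductive {Σ′} (c , c∈ , (A , K , e , eK , ends) , below-c) below-p peak
  with find peak
... | c′ , c′∈ , refl = K , subst (λ a → Σ′ ‼ a ≡ just (fam K)) target≡p eK , ends
  where
  target≡p : target A ≡ prio Σ′ c′
  target≡p =
    trans (sym (prio-con Σ′ e)) (ℕₚ.≤-antisym (All.lookup below-p c∈) (All.lookup below-c c′∈))

GuardedByPriorities : Sig → ℕ → ∀ {n} → Tm n → Set
GuardedByPriorities Σ′ r M =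
  ¬ Path Σ′ r M [] ×
  (∀ (c : Fin (length Σ′)) → let p = prio Σ′ (toℕ c) in CoinductiveFam Σ′ p ⊎ ¬ PeakPath Σ′ r M p)

guarded⇒guardedByPriorities : ∀ {Σ′ r n} {M : Tm n} → Guarded Σ′ r M → GuardedByPriorities Σ′ r M
guarded⇒guardedByPriorities {Σ′} {r} {M = M} g = (λ path → no-good-bare (g path)) , per-prio
  where
  no-good-bare : ¬ GoodPath Σ′ []
  no-good-bare (_ , () , _)
  per-prio : ∀ c → let p = prio Σ′ (toℕ c) in CoinductiveFam Σ′ p ⊎ ¬ PeakPath Σ′ r M p
  per-prio c with coinductiveFam? Σ′ (prio Σ′ (toℕ c))
  ... | yes coind = inj₁ coind
  ... | no ¬coind =
    inj₂ λ (_ , path , below , peak) → ¬coind (goodPath⇒coinductive {Σ′} (g path) below peak)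

guardedByPriorities⇒guarded : ∀ {Σ′ r n} {M : Tm n} → GuardedByPriorities Σ′ r M → Guarded Σ′ r M
guardedByPriorities⇒guarded (no-bare , per-prio) {[]}     path = ⊥-elim (no-bare path)
guardedByPriorities⇒guarded {Σ′} {r} {M = M} (no-bare , per-prio) {c ∷ cs} path =
  peak-good (All.lookup (path-cons path) peak∈)
  where
  peak = argmax (prio Σ′) c cs
  peak∈ : peak ∈ c ∷ cs
  peak∈ = argmax-all (prio Σ′) {P = _∈ c ∷ cs} (here refl) (All.tabulate there)
  below : All (λ c′ → prio Σ′ c′ ≤ prio Σ′ peak) (c ∷ cs)
  below = f[⊥]≤f[argmax] {f = prio Σ′} c cs ∷ f[xs]≤f[argmax] {f = prio Σ′} c cs
  peak-good : IsCon Σ′ peak → GoodPath Σ′ (c ∷ cs)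
  peak-good (A , e) with subst (λ q → CoinductiveFam Σ′ (prio Σ′ q) ⊎ ¬ PeakPath Σ′ r M (prio Σ′ q))
                              (Finₚ.toℕ-fromℕ< (‼-bound Σ′ e)) (per-prio (fromℕ< (‼-bound Σ′ e)))
  ... | inj₁ (K , eK , ends) =
    peak , peak∈ , (A , K , e , subst (λ a → Σ′ ‼ a ≡ just (fam K)) (prio-con Σ′ e) eK , ends) , below
  ... | inj₂ ¬peak = ⊥-elim (¬peak (c ∷ cs , path , below , lose peak∈ refl))

guarded? : ∀ Σ′ r {n} (M : Tm n) → Dec (Guarded Σ′ r M)
guarded? Σ′ r M = map′ guardedByPriorities⇒guarded guarded⇒guardedByPriorities
  (¬? (barePath? Σ′ r M) ×-dec Finₚ.all? λ c → coinductiveFam? Σ′ _ ⊎-dec ¬? (peakPath? Σ′ r M _))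

tyEq? : ∀ Σ′ {n} (Γ : Ctx n) (A B : Ty n) → Dec (TyEq Σ′ Γ A B)
tyEq? Σ′ Γ (atom a S) (atom b S′) =
  map′ (λ { (refl , eq) → atom eq }) (λ { (atom eq) → refl , eq }) (a ℕ.≟ b ×-dec spineEq? Σ′ S S′)
tyEq? Σ′ Γ (pi A B) (pi A′ B′) =
  map′ (uncurry pi) (λ { (pi p q) → p , q }) (tyEq? Σ′ Γ A A′ ×-dec tyEq? Σ′ (Γ ▸ (nrm , A)) B B′)
tyEq? Σ′ Γ (pih A B) (pih A′ B′) =
  map′ (uncurry pih) (λ { (pih p q) → p , q }) (tyEq? Σ′ Γ A A′ ×-dec tyEq? Σ′ (Γ ▸ (hat , A)) B B′)
tyEq? Σ′ Γ (atom _ _) (pi _ _)  = no λ ()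
tyEq? Σ′ Γ (atom _ _) (pih _ _) = no λ ()
tyEq? Σ′ Γ (pi _ _)   (atom _ _) = no λ ()
tyEq? Σ′ Γ (pi _ _)   (pih _ _) = no λ ()
tyEq? Σ′ Γ (pih _ _)  (atom _ _) = no λ ()
tyEq? Σ′ Γ (pih _ _)  (pi _ _)  = no λ ()

module Typing (E : Env) where
  open Env E

  tspine-functional : ∀ {n} {Γ : Ctx n} {S A P P′} → TSpine E Γ S A P → TSpine E Γ S A P′ → P ≡ P′
  tspine-functional nil nil = refl
  tspine-functional (cns _ e t) (cns _ e′ t′) with just-injective (trans (sym e) e′)
  ... | refl = tspine-functional t t′
  tspine-functional (pv _ _ t) (pv _ _ t′) = tspine-functional t t′

  kspine-functional : ∀ {n} {Γ : Ctx n} {S K K′ K″} → KSpine E Γ S K K′ → KSpine E Γ S K K″ → K′ ≡ K″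
  kspine-functional nil nil = refl
  kspine-functional (cns _ e k) (cns _ e′ k′) with just-injective (trans (sym e) e′)
  ... | refl = kspine-functional k k′
  kspine-functional (pv _ _ k) (pv _ _ k′) = kspine-functional k k′

  famSyn-functional : ∀ {n} {Γ : Ctx n} {a S K K′} → FamSyn E Γ a S K → FamSyn E Γ a S K′ → K ≡ K′
  famSyn-functional (fam e k) (fam e′ k′) with ‼-functional Ξ e e′
  ... | refl = kspine-functional k k′

  data HeadType {n} (Γ : Ctx n) : Head n → Ty n → Set where
    var : ∀ {x μ A} → lookupCtx Γ x ≡ (μ , A) → HeadType Γ (var x) A
    con : ∀ {c A} → Ξ ‼ c ≡ just (con A) → HeadType Γ (cst c) (clTy A)
    rec : ∀ {c A M} → recScope E ‼ c ≡ just (rc A M) → HeadType Γ (cst c) (clTy A)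

  headType? : ∀ {n} (Γ : Ctx n) {P : Ty n → Set} → (∀ A → Dec (P A)) → ∀ H →
              Dec (∃ λ A → HeadType Γ H A × P A)
  headType? Γ {P} P? (var x) =
    map′ (λ p → _ , var refl , p) (λ { (_ , var e , p) → subst P (sym (cong proj₂ e)) p })
      (P? (proj₂ (lookupCtx Γ x)))
  headType? Γ P? (cst c) =
    map′ (λ { (inj₁ (_ , e , p)) → _ , con e , p ; (inj₂ (_ , _ , e , p)) → _ , rec e , p })
         (λ { (_ , con e , p) → inj₁ (_ , e , p) ; (_ , rec e , p) → inj₂ (_ , _ , e , p) })
      (conWith? Ξ c (P? ∘ clTy) ⊎-dec recWith? (recScope E) c (P? ∘ clTy))

  syn⇒headType : ∀ {n} {Γ : Ctx n} {H S P} → Syn E Γ H S P → ∃ λ A → HeadType Γ H A × TSpine E Γ S A P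
  syn⇒headType (var e t) = _ , var e , t
  syn⇒headType (con e t) = _ , con e , t
  syn⇒headType (rec e t) = _ , rec e , t

  headType⇒syn : ∀ {n} {Γ : Ctx n} {H S A P} → HeadType Γ H A → TSpine E Γ S A P → Syn E Γ H S P
  headType⇒syn (var e) t = var e t
  headType⇒syn (con e) t = con e t
  headType⇒syn (rec e) t = rec e t

  mutual
    check? : ∀ {n} (Γ : Ctx n) M A → Dec (Check E Γ M A)
    check? Γ (lam M) (pi A₂ A₁)  = map′ lamPi (λ { (lamPi c) → c }) (check? (Γ ▸ (nrm , A₂)) M A₁)
    check? Γ (lam M) (pih A₂ A₁) = map′ lamPih (λ { (lamPih c) → c }) (check? (Γ ▸ (hat , A₂)) M A₁)
    check? Γ (lam _) (atom _ _)  = no λ ()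
    check? Γ (app _ _) (pi _ _)  = no λ ()
    check? Γ (app _ _) (pih _ _) = no λ ()
    check? Γ (app H S) (atom a S′) =
      map′ (λ (_ , h , P , t , q) → atom (headType⇒syn h t) q)
           (λ { (atom s q) → let A , h , t = syn⇒headType s in A , h , _ , t , q })
        (headType? Γ (λ A → tspineEq? Γ S A (atom a S′)) H)

    tspineEq? : ∀ {n} (Γ : Ctx n) S A T → Dec (∃ λ P → TSpine E Γ S A P × TyEq Σsig Γ P T)
    tspineEq? Γ S A T with tspine? Γ S A
    ... | no ∄t = no λ (P , t , _) → ∄t (P , t)
    ... | yes (P , t) =
      map′ (λ q → P , t , q)
           (λ (P′ , t′ , q) → subst (λ X → TyEq Σsig Γ X T) (tspine-functional t′ t) q)
        (tyEq? Σsig Γ P T)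

    tspine? : ∀ {n} (Γ : Ctx n) S A → Dec (∃ (TSpine E Γ S A))
    tspine? Γ nil (atom a S) = yes (_ , nil)
    tspine? Γ (M ∷ S) (pi A₂ A) with check? Γ M A₂ | hsubTy (erase A₂) zero M A in eq
    ... | no ¬c | _ = no λ { (_ , cns c _ _) → ¬c c }
    ... | yes c | nothing = no λ { (_ , cns _ e _) → case trans (sym eq) e of λ () }
    ... | yes c | just A₁ =
      map′ (λ (P , t) → P , cns c eq t)
           (λ { (P , cns _ e t) → P , subst (λ X → TSpine E Γ S X P) (just-injective (trans (sym e) eq)) t })
        (tspine? Γ S A₁)
    tspine? Γ (pv y S) (pih A₂ A) with lookupCtx Γ y in eq
    ... | nrm , _   = no λ { (_ , pv e _ _) → case trans (sym eq) e of λ () }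
    ... | hat , A₂′ =
      map′ (λ (q , P , t) → P , pv eq q t)
           (λ { (P , pv e q t) → subst (λ X → TyEq Σsig Γ X A₂) (cong proj₂ (trans (sym e) eq)) q , P , t })
        (tyEq? Σsig Γ A₂′ A₂ ×-dec tspine? Γ S (renTy [ y /0] A))
    tspine? Γ nil      (pi _ _)   = no λ { (_ , ()) }
    tspine? Γ nil      (pih _ _)  = no λ { (_ , ()) }
    tspine? Γ (_ ∷ _)  (atom _ _) = no λ { (_ , ()) }
    tspine? Γ (_ ∷ _)  (pih _ _)  = no λ { (_ , ()) }
    tspine? Γ (pv _ _) (atom _ _) = no λ { (_ , ()) }
    tspine? Γ (pv _ _) (pi _ _)   = no λ { (_ , ()) }

  syn? : ∀ {n} (Γ : Ctx n) H S → Dec (∃ (Syn E Γ H S))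
  syn? Γ H S =
    map′ (λ (_ , h , P , t) → P , headType⇒syn h t)
         (λ (P , s) → let A , h , t = syn⇒headType s in A , h , P , t)
      (headType? Γ (tspine? Γ S) H)

  kspine? : ∀ {n} (Γ : Ctx n) S K → Dec (∃ (KSpine E Γ S K))
  kspine? Γ nil K = yes (K , nil)
  kspine? Γ (M ∷ S) (pi A₂ K) with check? Γ M A₂ | hsubKd (erase A₂) zero M K in eq
  ... | no ¬c | _ = no λ { (_ , cns c _ _) → ¬c c }
  ... | yes c | nothing = no λ { (_ , cns _ e _) → case trans (sym eq) e of λ () }
  ... | yes c | just K₁ =
    map′ (λ (K′ , k) → K′ , cns c eq k)
         (λ { (K′ , cns _ e k) → K′ , subst (λ X → KSpine E Γ S X K′) (just-injective (trans (sym e) eq)) k })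
      (kspine? Γ S K₁)
  kspine? Γ (pv y S) (pih A₂ K) with lookupCtx Γ y in eq
  ... | nrm , _   = no λ { (_ , pv e _ _) → case trans (sym eq) e of λ () }
  ... | hat , A₂′ =
    map′ (λ (q , K′ , k) → K′ , pv eq q k)
         (λ { (K′ , pv e q k) → subst (λ X → TyEq Σsig Γ X A₂) (cong proj₂ (trans (sym e) eq)) q , K′ , k })
      (tyEq? Σsig Γ A₂′ A₂ ×-dec kspine? Γ S (renKd [ y /0] K))
  kspine? Γ (_ ∷ _)  type      = no λ { (_ , ()) }
  kspine? Γ (_ ∷ _)  cotype    = no λ { (_ , ()) }
  kspine? Γ (_ ∷ _)  (pih _ _) = no λ { (_ , ()) }
  kspine? Γ (pv _ _) type      = no λ { (_ , ()) }
  kspine? Γ (pv _ _) cotype    = no λ { (_ , ()) }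
  kspine? Γ (pv _ _) (pi _ _)  = no λ { (_ , ()) }

  famSyn? : ∀ {n} (Γ : Ctx n) a S → Dec (∃ (FamSyn E Γ a S))
  famSyn? Γ a S =
    map′ (λ (_ , e , K′ , k) → K′ , fam e k) (λ { (K′ , fam e k) → _ , e , K′ , k })
      (famWith? Ξ a (kspine? Γ S ∘ clKd))

  typeOK? : ∀ {n} (Γ : Ctx n) A → Dec (TypeOK E Γ A)
  typeOK? Γ (pi A B) =
    map′ (uncurry pi) (λ { (pi p q) → p , q })
      (typeOK? Γ A ×-dec typeOK? (Γ ▸ (nrm , A)) B)
  typeOK? Γ (pih A B) =
    map′ (uncurry pih) (λ { (pih p q) → p , q })
      (typeOK? Γ A ×-dec typeOK? (Γ ▸ (hat , A)) B)
  typeOK? Γ (atom a S) with famSyn? Γ a S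
  ... | no ∄f = no λ { (atomTy f) → ∄f (_ , f) ; (atomCo f) → ∄f (_ , f) }
  ... | yes (type , f)    = yes (atomTy f)
  ... | yes (cotype , f)  = yes (atomCo f)
  ... | yes (pi _ _ , f)  = no λ { (atomTy f′) → case famSyn-functional f f′ of λ ()
                                 ; (atomCo f′) → case famSyn-functional f f′ of λ () }
  ... | yes (pih _ _ , f) = no λ { (atomTy f′) → case famSyn-functional f f′ of λ ()
                                 ; (atomCo f′) → case famSyn-functional f f′ of λ () }

  kindOK? : ∀ {n} (Γ : Ctx n) K → Dec (KindOK E Γ K)
  kindOK? Γ type      = yes type
  kindOK? Γ cotype    = yes cotype
  kindOK? Γ (pi A K) =
    map′ (uncurry pi) (λ { (pi p q) → p , q })
      (typeOK? Γ A ×-dec kindOK? (Γ ▸ (nrm , A)) K)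
  kindOK? Γ (pih A K) =
    map′ (uncurry pih) (λ { (pih p q) → p , q })
      (typeOK? Γ A ×-dec kindOK? (Γ ▸ (hat , A)) K)

  ctxOK? : ∀ {n} (Γ : Ctx n) → Dec (CtxOK E Γ)
  ctxOK? ε             = yes ε
  ctxOK? (Γ ▸ (μ , A)) = map′ (uncurry _▸_) (λ { (p ▸ q) → p , q }) (ctxOK? Γ ×-dec typeOK? Γ A)

open Typing

prepatTy? : ∀ {n} (A : Ty n) → Dec (PrepatTy A)
prepatTy? (atom a S) = yes atom
prepatTy? (pi A B)   = no λ ()
prepatTy? (pih A B)  = map′ pih (λ { (pih p) → p }) (prepatTy? B)

recHeaded? : ∀ Σ′ {n} (M : Tm n) → Dec (RecHeaded Σ′ M)
recHeaded? Σ′ (lam M)         = map′ lam (λ { (lam h) → h }) (recHeaded? Σ′ M)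
recHeaded? Σ′ (app (var x) S) = no λ ()
recHeaded? Σ′ (app (cst c) S) = map′ (λ (_ , _ , e) → app e) (λ { (app e) → _ , _ , e }) (isRec? Σ′ c)

DeclOK : Sig → Sig → Decl → Set
DeclOK Σ′ Ξ (fam K)  = KindOK (env Ξ Σ′ false) ε K
DeclOK Σ′ Ξ (con A)  = TypeOK (env Ξ Σ′ false) ε A
DeclOK Σ′ Ξ (rc A M) = TypeOK (env Ξ Σ′ false) ε A × PrepatTy A × Contractive Σ′ M ×
                       Guarded Σ′ (length Ξ) M × Check (env Ξ Σ′ true) ε M A

declOK? : ∀ Σ′ Ξ d → Dec (DeclOK Σ′ Ξ d)
declOK? Σ′ Ξ (fam K)  = kindOK? (env Ξ Σ′ false) ε K
declOK? Σ′ Ξ (con A)  = typeOK? (env Ξ Σ′ false) ε A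
declOK? Σ′ Ξ (rc A M) =
  typeOK? (env Ξ Σ′ false) ε A ×-dec prepatTy? A ×-dec ¬? (recHeaded? Σ′ M) ×-dec
  guarded? Σ′ (length Ξ) M ×-dec check? (env Ξ Σ′ true) ε M A

sigOK-∷ʳ⁺ : ∀ {Σ′ Ξ d} → SigOK Σ′ Ξ × DeclOK Σ′ Ξ d → SigOK Σ′ (Ξ ∷ʳ d)
sigOK-∷ʳ⁺ {d = fam K}  (s , k)                  = fam s k
sigOK-∷ʳ⁺ {d = con A}  (s , t)                  = con s t
sigOK-∷ʳ⁺ {d = rc A M} (s , t , p , c , g , ch) = rc s t p c g ch

-- stated for an arbitrary list equal to Ξ ∷ʳ d, since _∷ʳ_ is not a constructor
sigOK-∷ʳ⁻ : ∀ {Σ′ L} Ξ d → L ≡ Ξ ∷ʳ d → SigOK Σ′ L → SigOK Σ′ Ξ × DeclOK Σ′ Ξ d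
sigOK-∷ʳ⁻ [] d () []
sigOK-∷ʳ⁻ (_ ∷ _) d () []
sigOK-∷ʳ⁻ Ξ d eq (fam {Ξ = Ξ′} s k) with ∷ʳ-injective Ξ′ Ξ eq
... | refl , refl = s , k
sigOK-∷ʳ⁻ Ξ d eq (con {Ξ = Ξ′} s t) with ∷ʳ-injective Ξ′ Ξ eq
... | refl , refl = s , t
sigOK-∷ʳ⁻ Ξ d eq (rc {Ξ = Ξ′} s t p c g ch) with ∷ʳ-injective Ξ′ Ξ eq
... | refl , refl = s , t , p , c , g , ch

sigOK? : ∀ Σ′ Ξ → Dec (SigOK Σ′ Ξ)
sigOK? Σ′ Ξ = go (reverseView Ξ)
  where
  go : ∀ {Ξ} → Reverse Ξ → Dec (SigOK Σ′ Ξ)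
  go []             = yes []
  go (Ξ′ ∶ rs ∶ʳ d) = map′ sigOK-∷ʳ⁺ (sigOK-∷ʳ⁻ Ξ′ d refl) (go rs ×-dec declOK? Σ′ Ξ′ d)

theorem5 :
    (∀ (Σs : Sig) → Dec (SigWF Σs)) ×
    (∀ (Σs Ξ : Sig) → Dec (SigOK Σs Ξ)) ×
    (∀ (E : Env) {n} (Γ : Ctx n) → Dec (CtxOK E Γ)) ×
    (∀ (E : Env) {n} (Γ : Ctx n) (K : Kd n) → Dec (KindOK E Γ K)) ×
    (∀ (E : Env) {n} (Γ : Ctx n) (A : Ty n) → Dec (TypeOK E Γ A)) ×
    (∀ (E : Env) {n} (Γ : Ctx n) (M : Tm n) (A : Ty n) → Dec (Check E Γ M A)) ×
    (∀ (Σs : Sig) {n} (Γ : Ctx n) (A₁ A₂ : Ty n) → Dec (TyEq Σs Γ A₁ A₂)) ×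
    (∀ (Σs : Sig) {n} (Γ : Ctx n) (a₁ a₂ : ℕ) (S₁ S₂ : Sp n) →
       Dec (TyEq Σs Γ (atom a₁ S₁) (atom a₂ S₂))) ×
    (∀ (E : Env) {n} (Γ : Ctx n) (a : ℕ) (S : Sp n) →
       Dec (∃ λ (K : Kd n) → FamSyn E Γ a S K)) ×
    (∀ (E : Env) {n} (Γ : Ctx n) (S : Sp n) (K : Kd n) →
       Dec (∃ λ (K' : Kd n) → KSpine E Γ S K K')) ×
    (∀ (E : Env) {n} (Γ : Ctx n) (H : Head n) (S : Sp n) →
       Dec (∃ λ (P : Ty n) → Syn E Γ H S P)) ×
    (∀ (E : Env) {n} (Γ : Ctx n) (S : Sp n) (A : Ty n) →
       Dec (∃ λ (P : Ty n) → TSpine E Γ S A P))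
theorem5 =
  (λ Σ′ → sigOK? Σ′ Σ′) ,
  sigOK? ,
  ctxOK? ,
  kindOK? ,
  typeOK? ,
  check? ,
  tyEq? ,
  (λ Σ′ Γ a₁ a₂ S₁ S₂ → tyEq? Σ′ Γ (atom a₁ S₁) (atom a₂ S₂)) ,
  famSyn? ,
  kspine? ,
  syn? ,
  tspine?
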